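{- Let $G$ be a finite simple cubic circle graph that does not have two disjoint pairs of twin vertices. Then $G$ is not $3$-connected.
   Context: All graphs are finite and simple; cubic means $3$-regular. A double occurrence word is a finite sequence in which each letter that appears, appears exactly twice; its interlacement graph has one vertex per letter, with $a,b$ adjacent iff the letters appear in the order $abab$ or $baba$. A circle graph is a simple graph isomorphic to such an interlacement graph. Two distinct vertices $v_1,v_2$ are twins if they have the same neighbors outside $\{v_1,v_2\}$. -}

module Defs where

open import Data.Nat using (ℕ; _≤_; _<_)
open import Data.Fin using (Fin)
open import Data.Fin.Properties using (_≟_)
open import Data.Bool using (Bool; T; true; false)
open import Data.Bool.Properties using (T?)
open import Data.List using (List; []; _∷_; length; filter; allFin)
open import Data.List.Membership.Propositional using (_∈_; _∉_)
open import Data.Product using (Σ; ∃; _×_; _,_)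
open import Data.Sum using (_⊎_)
open import Relation.Binary.PropositionalEquality using (_≡_; _≢_)
open import Relation.Nullary using (¬_)
open import Relation.Nullary.Decidable using (_⊎-dec_)
open import Function.Bundles using (_⇔_; _⤖_; Bijection)

record Graph (n : ℕ) : Set where
  field
    Adj    : Fin n → Fin n → Bool
    sym    : ∀ u v → Adj u v ≡ Adj v u
    irrefl : ∀ v → Adj v v ≡ false
open Graph public

degree : ∀ {n} → Graph n → Fin n → ℕ
degree {n} G v = length (filter (λ u → T? (Adj G v u)) (allFin n))

Cubic : ∀ {n} → Graph n → Set
Cubic G = ∀ v → degree G v ≡ 3

occurrences : ∀ {k} → Fin k → List (Fin k) → ℕ
occurrences a w = length (filter (λ x → x ≟ a) w)

DoubleOccurrenceWord : ∀ {k} → List (Fin k) → Set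
DoubleOccurrenceWord {k} w = ∀ (a : Fin k) → occurrences a w ≡ 2

restrict : ∀ {k} → Fin k → Fin k → List (Fin k) → List (Fin k)
restrict a b w = filter (λ x → (x ≟ a) ⊎-dec (x ≟ b)) w

Interlaced : ∀ {k} → List (Fin k) → Fin k → Fin k → Set
Interlaced w a b =
  restrict a b w ≡ a ∷ b ∷ a ∷ b ∷ [] ⊎ restrict a b w ≡ b ∷ a ∷ b ∷ a ∷ []

IsCircleGraph : ∀ {n} → Graph n → Set
IsCircleGraph {n} G =
  Σ ℕ λ k → Σ (List (Fin k)) λ w → DoubleOccurrenceWord w ×
    Σ (Fin n ⤖ Fin k) λ f →
      ∀ u v → T (Adj G u v) ⇔ Interlaced w (Bijection.to f u) (Bijection.to f v)

Twins : ∀ {n} → Graph n → Fin n → Fin n → Set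
Twins G v₁ v₂ = v₁ ≢ v₂ × (∀ u → u ≢ v₁ → u ≢ v₂ → Adj G v₁ u ≡ Adj G v₂ u)

HasTwoDisjointTwinPairs : ∀ {n} → Graph n → Set
HasTwoDisjointTwinPairs G =
  ∃ λ v₁ → ∃ λ v₂ → ∃ λ v₃ → ∃ λ v₄ →
    Twins G v₁ v₂ × Twins G v₃ v₄ ×
    v₁ ≢ v₃ × v₁ ≢ v₄ × v₂ ≢ v₃ × v₂ ≢ v₄

data Reach {n} (G : Graph n) (S : List (Fin n)) (u : Fin n) : Fin n → Set where
  here : u ∉ S → Reach G S u u
  step : ∀ {v w} → Reach G S u v → T (Adj G v w) → w ∉ S → Reach G S u w

ConnectedWithout : ∀ {n} → Graph n → List (Fin n) → Set
ConnectedWithout {n} G S = ∀ (u v : Fin n) → u ∉ S → v ∉ S → Reach G S u v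

KConnected : ℕ → ∀ {n} → Graph n → Set
KConnected k {n} G =
  k < n × (∀ (X : List (Fin n)) → length X < k → ConnectedWithout G X)

-- Read the graph as the interlacement graph of a double occurrence word w. Cubicity says that
-- exactly three letters occur once between the two occurrences of any letter, and 3-connectivity
-- forbids any segment of w that contains a letter twice, misses another letter, and has at most
-- two letters occurring once (those would form a cut of size at most two). Pick a letter z. If a
-- side of z contains a repeated letter, take an innermost chord whose inside repeats a letter:
-- its inside is u b₁ b₂ b₃ u or u a v b u c v. The second shape forces the triangular prism,
-- which does not fit the word; the first makes the enclosing chord and u twins, and the other
-- side of that chord then contains a second, disjoint pair of twins. If neither side of z
-- repeats a letter, every letter crosses z, the graph is K₄, and K₄ has two disjoint twin pairs.

module Submission where

open import Algebra.Properties.CommutativeSemigroup using (interchange)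
open import Data.Bool using (Bool; true; false; T)
open import Data.Bool.Properties using (T?)
open import Data.Empty using (⊥; ⊥-elim)
open import Data.Fin using (Fin; zero; suc; punchIn)
open import Data.Fin.Properties using (_≟_; punchInᵢ≢i)
open import Data.List using (List; []; _∷_; _++_; length; filter; replicate; tabulate; allFin; map; initLast; _∷ʳ′_)
open import Data.List.Properties
  using (filter-++; length-++; length-map; ++-assoc; ++-identityʳ; ∷-injectiveˡ; ∷-injectiveʳ)
open import Data.List.Membership.Propositional using (_∈_; _∉_)
open import Data.List.Membership.Propositional.Properties using (∈-filter⁺; ∈-filter⁻; ∈-allFin; ∈-map⁺; ∈-map⁻)
open import Data.List.Relation.Unary.All using (All; _∷_; [])
open import Data.List.Relation.Unary.AllPairs using (_∷_)
open import Data.List.Relation.Unary.Any using (here; there)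
open import Data.List.Relation.Unary.Unique.Propositional using (Unique)
open import Data.List.Relation.Unary.Unique.Propositional.Properties using (filter⁺; allFin⁺)
open import Data.Nat as ℕ using (ℕ; zero; suc; _+_; _*_; _%_; _≤_; z≤n; s≤s)
open import Data.Nat.DivMod using ([m+kn]%n≡m%n)
open import Data.Nat.Properties
  using (suc-injective; 0≢1+n; 1+n≢0; +-suc; +-comm; +-assoc; +-identityʳ; *-comm; *-distribˡ-+;
         +-cancelʳ-≡; +-cancelˡ-≤; +-cancelʳ-≤; +-monoˡ-≤; +-monoʳ-≤; m+n≡0⇒m≡0; m+n≡0⇒n≡0;
         n≤1+n; ≤-refl; ≤-trans; ≤-reflexive; ≤-antisym; ≤-pred; m≤m+n; m≤n+m; n≤0⇒n≡0; <⇒≱; ≤∧≢⇒<; ≰⇒>;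
         m≤n⇒m<n∨m≡n; +-commutativeSemigroup; +-*-semiring; module ≤-Reasoning)
open import Algebra.Properties.Semiring.Sum +-*-semiring
  using (sum; sum-syntax; sum-cong-≗; sum-remove; sum-replicate-zero; ∑-distrib-+; *-distribˡ-sum)
open import Data.Product using (Σ; _×_; _,_; proj₁; proj₂)
open import Data.Sum using (_⊎_; inj₁; inj₂; map₂)
open import Function using (_∘_; id)
open import Function.Bundles using (_⇔_; _⤖_; Bijection; Equivalence)
open import Relation.Binary.PropositionalEquality
open import Relation.Nullary using (¬_; Dec; yes; no)
open import Relation.Nullary.Decidable using (_⊎-dec_)
open import Relation.Unary using (Decidable)
open import Defs hiding (sym)

-- Double occurrence words and interlacement

Word : ℕ → Set
Word k = List (Fin k)

module _ {k : ℕ} where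

  occ : Fin k → Word k → ℕ
  occ = occurrences

  occ-∷-≢ : ∀ {a x} (w : Word k) → x ≢ a → occ a (x ∷ w) ≡ occ a w
  occ-∷-≢ {a} {x} w x≢a with x ≟ a
  ... | yes x≡a = ⊥-elim (x≢a x≡a)
  ... | no _ = refl

  occ-head : ∀ a (w : Word k) → occ a (a ∷ w) ≡ suc (occ a w)
  occ-head a w with a ≟ a
  ... | yes _ = refl
  ... | no a≢a = ⊥-elim (a≢a refl)

  occ-++ : ∀ a (u v : Word k) → occ a (u ++ v) ≡ occ a u + occ a v
  occ-++ a u v = trans (cong length (filter-++ (_≟ a) u v)) (length-++ (filter (_≟ a) u))

  occ-∷ʳ-≢ : ∀ {a y} (w : Word k) → y ≢ a → occ a (w ++ y ∷ []) ≡ occ a w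
  occ-∷ʳ-≢ {a} w y≢a = trans (occ-++ a w _) (trans (cong (occ a w +_) (occ-∷-≢ [] y≢a)) (+-identityʳ _))

  split-at-first : ∀ a n (w : Word k) → occ a w ≡ suc n →
    Σ (Word k) λ P → Σ (Word k) λ R → w ≡ P ++ a ∷ R × occ a P ≡ 0 × occ a R ≡ n
  split-at-first a n [] ()
  split-at-first a n (x ∷ w) occ≡ with x ≟ a
  ... | yes refl = [] , w , refl , refl , suc-injective occ≡
  ... | no x≢a with split-at-first a n w occ≡
  ... | P , R , refl , occ-P , occ-R = x ∷ P , R , refl , trans (occ-∷-≢ P x≢a) occ-P , occ-R

  record Chord (a : Fin k) (w : Word k) : Set where
    constructor chord
    field
      P B Q : Word k
      split : w ≡ P ++ a ∷ B ++ a ∷ Q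
      occ-P : occ a P ≡ 0
      occ-B : occ a B ≡ 0
      occ-Q : occ a Q ≡ 0

  chord-of : ∀ a (w : Word k) → occ a w ≡ 2 → Chord a w
  chord-of a w occ≡2 with split-at-first a 1 w occ≡2
  ... | P , R , refl , occ-P , occ-R with split-at-first a 0 R occ-R
  ... | B , Q , refl , occ-B , occ-Q = chord P B Q refl occ-P occ-B occ-Q

  restrict-++ : ∀ a b (u v : Word k) → restrict a b (u ++ v) ≡ restrict a b u ++ restrict a b v
  restrict-++ a b u v = filter-++ (λ x → (x ≟ a) ⊎-dec (x ≟ b)) u v

  restrict-head : ∀ a b (w : Word k) → restrict a b (a ∷ w) ≡ a ∷ restrict a b w
  restrict-head a b w with a ≟ a
  ... | yes _ = refl
  ... | no a≢a = ⊥-elim (a≢a refl)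

  restrict-absent : ∀ a b (w : Word k) → occ a w ≡ 0 → restrict a b w ≡ replicate (occ b w) b
  restrict-absent a b [] _ = refl
  restrict-absent a b (x ∷ w) occ≡0 with x ≟ a
  ... | yes _ = ⊥-elim (0≢1+n (sym occ≡0))
  ... | no _ with x ≟ b
  ...   | yes refl = cong (x ∷_) (restrict-absent a b w occ≡0)
  ...   | no _ = restrict-absent a b w occ≡0

  restrict-comm : ∀ a b (w : Word k) → restrict a b w ≡ restrict b a w
  restrict-comm a b [] = refl
  restrict-comm a b (x ∷ w) with x ≟ a | x ≟ b
  ... | yes _ | yes _ = cong (x ∷_) (restrict-comm a b w)
  ... | yes _ | no _ = cong (x ∷_) (restrict-comm a b w)
  ... | no _ | yes _ = cong (x ∷_) (restrict-comm a b w)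
  ... | no _ | no _ = restrict-comm a b w

  restrict-chord : ∀ a b (P B Q : Word k) → occ a P ≡ 0 → occ a B ≡ 0 → occ a Q ≡ 0 →
    restrict a b (P ++ a ∷ B ++ a ∷ Q) ≡
    replicate (occ b P) b ++ a ∷ replicate (occ b B) b ++ a ∷ replicate (occ b Q) b
  restrict-chord a b P B Q occ-P occ-B occ-Q = begin
      restrict a b (P ++ a ∷ B ++ a ∷ Q)
    ≡⟨ restrict-++ a b P _ ⟩
      r P ++ r (a ∷ B ++ a ∷ Q)
    ≡⟨ cong (r P ++_) (restrict-head a b _) ⟩
      r P ++ a ∷ r (B ++ a ∷ Q)
    ≡⟨ cong (λ t → r P ++ a ∷ t) (restrict-++ a b B _) ⟩
      r P ++ a ∷ r B ++ r (a ∷ Q)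
    ≡⟨ cong (λ t → r P ++ a ∷ r B ++ t) (restrict-head a b Q) ⟩
      r P ++ a ∷ r B ++ a ∷ r Q
    ≡⟨ cong₂ (λ s t → s ++ a ∷ t) (restrict-absent a b P occ-P)
         (cong₂ (λ s t → s ++ a ∷ t) (restrict-absent a b B occ-B) (restrict-absent a b Q occ-Q)) ⟩
      replicate (occ b P) b ++ a ∷ replicate (occ b B) b ++ a ∷ replicate (occ b Q) b
    ∎
    where
    open ≡-Reasoning
    r : Word k → Word k
    r = restrict a b

  interlaced-sym : ∀ (w : Word k) a b → Interlaced w a b → Interlaced w b a
  interlaced-sym w a b (inj₁ eq) = inj₂ (trans (restrict-comm b a w) eq)
  interlaced-sym w a b (inj₂ eq) = inj₁ (trans (restrict-comm b a w) eq)

  rotate-abab : ∀ (p q : Fin k) (u v : Word k) → u ++ v ≡ p ∷ q ∷ p ∷ q ∷ [] →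
    v ++ u ≡ p ∷ q ∷ p ∷ q ∷ [] ⊎ v ++ u ≡ q ∷ p ∷ q ∷ p ∷ []
  rotate-abab p q [] v refl = inj₁ (++-identityʳ v)
  rotate-abab p q (_ ∷ []) v refl = inj₂ refl
  rotate-abab p q (_ ∷ _ ∷ []) v refl = inj₁ refl
  rotate-abab p q (_ ∷ _ ∷ _ ∷ []) v refl = inj₂ refl
  rotate-abab p q (_ ∷ _ ∷ _ ∷ _ ∷ []) [] refl = inj₁ refl

  interlaced-rotate : ∀ (u v : Word k) a b → Interlaced (u ++ v) a b → Interlaced (v ++ u) a b
  interlaced-rotate u v a b (inj₁ eq)
    with rotate-abab a b (restrict a b u) (restrict a b v) (trans (sym (restrict-++ a b u v)) eq)
  ... | inj₁ eq′ = inj₁ (trans (restrict-++ a b v u) eq′)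
  ... | inj₂ eq′ = inj₂ (trans (restrict-++ a b v u) eq′)
  interlaced-rotate u v a b (inj₂ eq)
    with rotate-abab b a (restrict a b u) (restrict a b v) (trans (sym (restrict-++ a b u v)) eq)
  ... | inj₁ eq′ = inj₂ (trans (restrict-++ a b v u) eq′)
  ... | inj₂ eq′ = inj₁ (trans (restrict-++ a b v u) eq′)

  occ-chord-≢ : ∀ {a b} (P B Q : Word k) → b ≢ a →
    occ b (P ++ a ∷ B ++ a ∷ Q) ≡ occ b P + (occ b B + occ b Q)
  occ-chord-≢ {a} {b} P B Q b≢a = begin
      occ b (P ++ a ∷ B ++ a ∷ Q)
    ≡⟨ occ-++ b P _ ⟩
      occ b P + occ b (a ∷ B ++ a ∷ Q)
    ≡⟨ cong (occ b P +_) (occ-∷-≢ (B ++ a ∷ Q) a≢b) ⟩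
      occ b P + occ b (B ++ a ∷ Q)
    ≡⟨ cong (occ b P +_) (occ-++ b B (a ∷ Q)) ⟩
      occ b P + (occ b B + occ b (a ∷ Q))
    ≡⟨ cong (λ t → occ b P + (occ b B + t)) (occ-∷-≢ Q a≢b) ⟩
      occ b P + (occ b B + occ b Q)
    ∎
    where
    open ≡-Reasoning
    a≢b : a ≢ b
    a≢b a≡b = b≢a (sym a≡b)

  occ-chord-≡ : ∀ a (P B Q : Word k) → occ a (P ++ a ∷ B ++ a ∷ Q) ≡ occ a P + suc (occ a B + suc (occ a Q))
  occ-chord-≡ a P B Q = trans (occ-++ a P _) (cong (occ a P +_) (trans (occ-head a (B ++ a ∷ Q))
    (cong suc (trans (occ-++ a B (a ∷ Q)) (cong (occ a B +_) (occ-head a Q))))))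

  inside-abab : ∀ {a b : Fin k} → a ≢ b → ∀ i j l →
    replicate i b ++ a ∷ replicate j b ++ a ∷ replicate l b ≡ a ∷ b ∷ a ∷ b ∷ [] → j ≡ 1
  inside-abab a≢b zero zero l eq = ⊥-elim (a≢b (∷-injectiveˡ (∷-injectiveʳ eq)))
  inside-abab a≢b zero (suc zero) l eq = refl
  inside-abab a≢b zero (suc (suc j)) l eq = ⊥-elim (a≢b (sym (∷-injectiveˡ (∷-injectiveʳ (∷-injectiveʳ eq)))))
  inside-abab a≢b (suc i) j l eq = ⊥-elim (a≢b (sym (∷-injectiveˡ eq)))

  inside-baba : ∀ {a b : Fin k} → a ≢ b → ∀ i j l →
    replicate i b ++ a ∷ replicate j b ++ a ∷ replicate l b ≡ b ∷ a ∷ b ∷ a ∷ [] → j ≡ 1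
  inside-baba a≢b zero j l eq = ⊥-elim (a≢b (∷-injectiveˡ eq))
  inside-baba a≢b (suc zero) zero l eq = ⊥-elim (a≢b (∷-injectiveˡ (∷-injectiveʳ (∷-injectiveʳ eq))))
  inside-baba a≢b (suc zero) (suc zero) l eq = refl
  inside-baba a≢b (suc zero) (suc (suc j)) l eq = ⊥-elim (a≢b (sym (∷-injectiveˡ (∷-injectiveʳ (∷-injectiveʳ (∷-injectiveʳ eq))))))
  inside-baba a≢b (suc (suc i)) j l eq = ⊥-elim (a≢b (sym (∷-injectiveˡ (∷-injectiveʳ eq))))

  abab-or-baba : ∀ (a b : Fin k) p q → p + suc q ≡ 2 →
    replicate p b ++ a ∷ b ∷ a ∷ replicate q b ≡ a ∷ b ∷ a ∷ b ∷ [] ⊎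
    replicate p b ++ a ∷ b ∷ a ∷ replicate q b ≡ b ∷ a ∷ b ∷ a ∷ []
  abab-or-baba a b zero (suc zero) _ = inj₁ refl
  abab-or-baba a b (suc zero) zero _ = inj₂ refl
  abab-or-baba a b (suc (suc p)) q eq = ⊥-elim (0≢1+n (sym (trans (sym (+-suc p q)) (suc-injective (suc-injective eq)))))

  chord-irrefl : ∀ {a w} → Chord a w → ¬ Interlaced w a a
  chord-irrefl {a} (chord P B Q refl occ-P occ-B occ-Q) int with restrict-chord a a P B Q occ-P occ-B occ-Q
  ... | eq rewrite occ-P | occ-B | occ-Q with int
  ... | inj₁ eq′ with () ← trans (sym eq) eq′
  ... | inj₂ eq′ with () ← trans (sym eq) eq′

  interlaced⇒occ-inside≡1 : ∀ {a b w} (ch : Chord a w) → Interlaced w a b → occ b (Chord.B ch) ≡ 1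
  interlaced⇒occ-inside≡1 {a} {b} ch@(chord P B Q refl occ-P occ-B occ-Q) int with a ≟ b
  ... | yes refl = ⊥-elim (chord-irrefl ch int)
  ... | no a≢b with int
  ...   | inj₁ eq = inside-abab a≢b _ _ _ (trans (sym (restrict-chord a b P B Q occ-P occ-B occ-Q)) eq)
  ...   | inj₂ eq = inside-baba a≢b _ _ _ (trans (sym (restrict-chord a b P B Q occ-P occ-B occ-Q)) eq)

  occ-inside≡1⇒interlaced : ∀ {a b w} (ch : Chord a w) → occ b w ≡ 2 → occ b (Chord.B ch) ≡ 1 →
    Interlaced w a b
  occ-inside≡1⇒interlaced {a} {b} (chord P B Q refl occ-P occ-B occ-Q) occ≡2 inside≡1
    rewrite restrict-chord a b P B Q occ-P occ-B occ-Q | inside≡1 =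
    abab-or-baba a b (occ b P) (occ b Q) total
    where
    b≢a : b ≢ a
    b≢a refl = 0≢1+n (trans (sym occ-B) inside≡1)
    total : occ b P + suc (occ b Q) ≡ 2
    total = trans (cong (λ t → occ b P + (t + occ b Q)) (sym inside≡1))
                  (trans (sym (occ-chord-≢ P B Q b≢a)) occ≡2)

-- Counting letters

chord-counts : ∀ p b q → p + suc (b + suc q) ≡ 2 → p ≡ 0 × b ≡ 0 × q ≡ 0
chord-counts p b q eq = m+n≡0⇒m≡0 p rest≡0 , m+n≡0⇒m≡0 b (m+n≡0⇒n≡0 p rest≡0) , m+n≡0⇒n≡0 b (m+n≡0⇒n≡0 p rest≡0)
  where
  open ≡-Reasoning
  rest≡0 : p + (b + q) ≡ 0
  rest≡0 = suc-injective (suc-injective (begin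
    suc (suc (p + (b + q)))  ≡⟨ cong suc (sym (+-suc p (b + q))) ⟩
    suc (p + suc (b + q))    ≡⟨ cong (λ t → suc (p + t)) (sym (+-suc b q)) ⟩
    suc (p + (b + suc q))    ≡⟨ sym (+-suc p _) ⟩
    p + suc (b + suc q)      ≡⟨ eq ⟩
    2                        ∎))

module _ {k : ℕ} where

  occ-∷-≤ : ∀ c x (w : Word k) → occ c w ≤ occ c (x ∷ w)
  occ-∷-≤ c x w with x ≟ c
  ... | yes _ = n≤1+n _
  ... | no _ = ≤-refl

  occ-++ˡ-≤ : ∀ c (u v : Word k) → occ c u ≤ occ c (u ++ v)
  occ-++ˡ-≤ c u v = ≤-trans (m≤m+n _ _) (≤-reflexive (sym (occ-++ c u v)))

  occ-++ʳ-≤ : ∀ c (u v : Word k) → occ c v ≤ occ c (u ++ v)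
  occ-++ʳ-≤ c u v = ≤-trans (m≤n+m _ _) (≤-reflexive (sym (occ-++ c u v)))

  occ-infix-≤ : ∀ c (A X C : Word k) → occ c X ≤ occ c (A ++ X ++ C)
  occ-infix-≤ c A X C = ≤-trans (occ-++ˡ-≤ c X C) (occ-++ʳ-≤ c A (X ++ C))

  occ-inside-≤ : ∀ c y (P B Q : Word k) → occ c B ≤ occ c (P ++ y ∷ B ++ y ∷ Q)
  occ-inside-≤ c y P B Q = ≤-trans (occ-++ˡ-≤ c B (y ∷ Q)) (≤-trans (occ-∷-≤ c y (B ++ y ∷ Q)) (occ-++ʳ-≤ c P _))

  occ-chord-≥2 : ∀ a (P B Q : Word k) → 2 ≤ occ a (P ++ a ∷ B ++ a ∷ Q)
  occ-chord-≥2 a P B Q = begin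
    2                               ≤⟨ s≤s (s≤s z≤n) ⟩
    suc (suc (occ a Q))             ≡⟨ cong suc (sym (occ-head a Q)) ⟩
    suc (occ a (a ∷ Q))             ≤⟨ s≤s (occ-++ʳ-≤ a B (a ∷ Q)) ⟩
    suc (occ a (B ++ a ∷ Q))        ≡⟨ sym (occ-head a _) ⟩
    occ a (a ∷ B ++ a ∷ Q)          ≤⟨ occ-++ʳ-≤ a P _ ⟩
    occ a (P ++ a ∷ B ++ a ∷ Q)     ∎
    where open ≤-Reasoning

  ++-assoc-chord : ∀ (A Y₁ : Word k) x (M Y₃ C : Word k) →
    A ++ (Y₁ ++ x ∷ M ++ x ∷ Y₃) ++ C ≡ (A ++ Y₁) ++ x ∷ M ++ x ∷ (Y₃ ++ C)
  ++-assoc-chord A Y₁ x M Y₃ C = trans (cong (A ++_) (++-assoc Y₁ _ C))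
    (trans (sym (++-assoc A Y₁ _)) (cong (λ t → (A ++ Y₁) ++ x ∷ t) (++-assoc M (x ∷ Y₃) C)))

  length-infix-≤ : ∀ (A Y C : Word k) → length Y ≤ length (A ++ Y ++ C)
  length-infix-≤ A Y C = ≤-trans (≤-trans (m≤m+n _ _) (≤-reflexive (sym (length-++ Y))))
                                 (≤-trans (m≤n+m _ _) (≤-reflexive (sym (length-++ A))))

  occ-∈-≥1 : ∀ x (A B : Word k) → 1 ≤ occ x (A ++ x ∷ B)
  occ-∈-≥1 x A B = ≤-trans (≤-trans (s≤s z≤n) (≤-reflexive (sym (occ-head x B)))) (occ-++ʳ-≤ x A (x ∷ B))

  occ-∉ : ∀ {c} (L : Word k) → All (c ≢_) L → occ c L ≡ 0
  occ-∉ [] [] = refl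
  occ-∉ (x ∷ L) (c≢x ∷ c∉L) = trans (occ-∷-≢ L (≢-sym c≢x)) (occ-∉ L c∉L)

  occ-once : ∀ {c} (A B : Word k) → All (c ≢_) A → All (c ≢_) B → occ c (A ++ c ∷ B) ≡ 1
  occ-once {c} A B c∉A c∉B =
    trans (occ-++ c A (c ∷ B)) (cong₂ _+_ (occ-∉ A c∉A) (trans (occ-head c B) (cong suc (occ-∉ B c∉B))))

indicator : ∀ {p} {P : Set p} → Dec P → ℕ
indicator (yes _) = 1
indicator (no _) = 0

indicator-yes : ∀ {p} {P : Set p} (d : Dec P) → P → indicator d ≡ 1
indicator-yes (yes _) _ = refl
indicator-yes (no ¬p) p = ⊥-elim (¬p p)

indicator-no : ∀ {p} {P : Set p} (d : Dec P) → ¬ P → indicator d ≡ 0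
indicator-no (yes p) ¬p = ⊥-elim (¬p p)
indicator-no (no _) _ = refl

length-filter-tabulate : ∀ {k m} {P : Fin k → Set} (P? : Decidable P) (f : Fin m → Fin k) →
  length (filter P? (tabulate f)) ≡ ∑[ i < m ] indicator (P? (f i))
length-filter-tabulate {m = zero} P? f = refl
length-filter-tabulate {m = suc m} P? f with P? (f zero)
... | yes _ = cong suc (length-filter-tabulate P? (λ i → f (suc i)))
... | no _ = length-filter-tabulate P? (λ i → f (suc i))

sum-agree-except : ∀ {k} (f g : Fin k → ℕ) (x : Fin k) → (∀ i → i ≢ x → f i ≡ g i) →
  sum f + g x ≡ sum g + f x
sum-agree-except {suc k} f g x agree = begin
    sum f + g x
  ≡⟨ cong (_+ g x) (sum-remove {i = x} f) ⟩
    f x + sum (f ∘ punchIn x) + g x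
  ≡⟨ cong (λ t → f x + t + g x) (sum-cong-≗ (λ j → agree (punchIn x j) (punchInᵢ≢i x j))) ⟩
    f x + sum (g ∘ punchIn x) + g x
  ≡⟨ +-comm (f x + _) (g x) ⟩
    g x + (f x + sum (g ∘ punchIn x))
  ≡⟨ cong (g x +_) (+-comm (f x) _) ⟩
    g x + (sum (g ∘ punchIn x) + f x)
  ≡⟨ sym (+-assoc (g x) _ (f x)) ⟩
    g x + sum (g ∘ punchIn x) + f x
  ≡⟨ cong (_+ f x) (sym (sum-remove {i = x} g)) ⟩
    sum g + f x
  ∎
  where open ≡-Reasoning

sum-occ-singleton : ∀ {k} (x : Fin k) → ∑[ c < k ] occ c (x ∷ []) ≡ 1
sum-occ-singleton {suc k} x = trans (sum-remove {i = x} (λ c → occ c (x ∷ [])))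
  (cong₂ _+_ (occ-head x []) (trans (sum-cong-≗ (λ j → occ-∷-≢ [] (λ x≡ → punchInᵢ≢i x j (sym x≡)))) (sum-replicate-zero k)))

module _ {k : ℕ} where

  #once : Word k → ℕ
  #once w = ∑[ c < k ] indicator (occ c w ℕ.≟ 1)

  #twice : Word k → ℕ
  #twice w = ∑[ c < k ] indicator (occ c w ℕ.≟ 2)

  sum-occ : ∀ (w : Word k) → ∑[ c < k ] occ c w ≡ length w
  sum-occ [] = sum-replicate-zero k
  sum-occ (x ∷ w) = begin
      ∑[ c < k ] occ c (x ∷ w)
    ≡⟨ sum-cong-≗ (λ c → occ-++ c (x ∷ []) w) ⟩
      ∑[ c < k ] (occ c (x ∷ []) + occ c w)
    ≡⟨ ∑-distrib-+ (λ c → occ c (x ∷ [])) (λ c → occ c w) ⟩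
      ∑[ c < k ] occ c (x ∷ []) + ∑[ c < k ] occ c w
    ≡⟨ cong₂ _+_ (sum-occ-singleton x) (sum-occ w) ⟩
      suc (length w)
    ∎
    where open ≡-Reasoning

  length≡#once+2*#twice : ∀ (w : Word k) → (∀ c → occ c w ≤ 2) → length w ≡ #once w + 2 * #twice w
  length≡#once+2*#twice w occ≤2 = begin
      length w
    ≡⟨ sym (sum-occ w) ⟩
      ∑[ c < k ] occ c w
    ≡⟨ sum-cong-≗ (λ c → by-value (occ c w) (occ≤2 c)) ⟩
      ∑[ c < k ] (indicator (occ c w ℕ.≟ 1) + 2 * indicator (occ c w ℕ.≟ 2))
    ≡⟨ ∑-distrib-+ (λ c → indicator (occ c w ℕ.≟ 1)) (λ c → 2 * indicator (occ c w ℕ.≟ 2)) ⟩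
      #once w + ∑[ c < k ] (2 * indicator (occ c w ℕ.≟ 2))
    ≡⟨ cong (#once w +_) (sym (*-distribˡ-sum 2 (λ c → indicator (occ c w ℕ.≟ 2)))) ⟩
      #once w + 2 * #twice w
    ∎
    where
    open ≡-Reasoning
    by-value : ∀ n → n ≤ 2 → n ≡ indicator (n ℕ.≟ 1) + 2 * indicator (n ℕ.≟ 2)
    by-value zero _ = refl
    by-value (suc zero) _ = refl
    by-value (suc (suc zero)) _ = refl
    by-value (suc (suc (suc _))) (s≤s (s≤s ()))

  #once-insert : ∀ x (u v : Word k) → occ x (u ++ v) ≡ 0 → #once (u ++ x ∷ v) ≡ suc (#once (u ++ v))
  #once-insert x u v absent = begin
      #once (u ++ x ∷ v)
    ≡⟨ sym (+-identityʳ _) ⟩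
      #once (u ++ x ∷ v) + 0
    ≡⟨ cong (#once (u ++ x ∷ v) +_) (sym (indicator-no (occ x (u ++ v) ℕ.≟ 1) (λ eq → 0≢1+n (trans (sym absent) eq)))) ⟩
      #once (u ++ x ∷ v) + indicator (occ x (u ++ v) ℕ.≟ 1)
    ≡⟨ sum-agree-except _ _ x (λ c c≢x → cong (λ t → indicator (t ℕ.≟ 1)) (occ-insert-≢ c c≢x)) ⟩
      #once (u ++ v) + indicator (occ x (u ++ x ∷ v) ℕ.≟ 1)
    ≡⟨ cong (#once (u ++ v) +_) (indicator-yes (occ x (u ++ x ∷ v) ℕ.≟ 1) occ-x) ⟩
      #once (u ++ v) + 1
    ≡⟨ +-comm (#once (u ++ v)) 1 ⟩
      suc (#once (u ++ v))
    ∎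
    where
    open ≡-Reasoning
    occ-insert-≢ : ∀ c → c ≢ x → occ c (u ++ x ∷ v) ≡ occ c (u ++ v)
    occ-insert-≢ c c≢x = trans (occ-++ c u (x ∷ v))
      (trans (cong (occ c u +_) (occ-∷-≢ v (λ x≡c → c≢x (sym x≡c)))) (sym (occ-++ c u v)))
    occ-x : occ x (u ++ x ∷ v) ≡ 1
    occ-x = trans (occ-++ x u (x ∷ v)) (trans (cong (occ x u +_) (occ-head x v))
      (trans (+-suc (occ x u) (occ x v)) (cong suc (trans (sym (occ-++ x u v)) absent))))

  #twice≡0 : ∀ (w : Word k) → (∀ c → occ c w ≤ 1) → #twice w ≡ 0
  #twice≡0 w occ≤1 = trans (sum-cong-≗ (λ c → indicator-no (occ c w ℕ.≟ 2) (λ eq → 2≰1 (subst (_≤ 1) eq (occ≤1 c)))))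
                           (sum-replicate-zero k)
    where
    2≰1 : ¬ 2 ≤ 1
    2≰1 (s≤s ())

3+2*-odd : ∀ m → (3 + 2 * m) % 2 ≡ 1
3+2*-odd m = trans (cong (λ t → (3 + t) % 2) (*-comm 2 m)) ([m+kn]%n≡m%n 3 m 2)

once-overlap-arith : ∀ o₁ o₂ t₁ t₂ ℓ → o₁ + 2 * t₁ ≡ 8 → o₂ + 2 * t₂ ≡ ℓ → 4 + ℓ ≡ 3 + 2 * (t₁ + t₂) →
  o₁ + o₂ ≡ 7
once-overlap-arith o₁ o₂ t₁ t₂ ℓ eq₁ eq₂ eq = +-cancelʳ-≡ (suc ℓ) (o₁ + o₂) 7 (begin
    o₁ + o₂ + suc ℓ              ≡⟨ cong (o₁ + o₂ +_) (trans (suc-injective (suc-injective (suc-injective eq)))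
                                                             (*-distribˡ-+ 2 t₁ t₂)) ⟩
    o₁ + o₂ + (2 * t₁ + 2 * t₂)  ≡⟨ interchange +-commutativeSemigroup o₁ o₂ (2 * t₁) (2 * t₂) ⟩
    (o₁ + 2 * t₁) + (o₂ + 2 * t₂) ≡⟨ cong₂ _+_ eq₁ eq₂ ⟩
    8 + ℓ                        ∎)
  where open ≡-Reasoning

-- Counterexample words

module _ {k : ℕ} where

  OneOf : Fin k → Fin k → Fin k → Fin k → Set
  OneOf c x y z = c ≡ x ⊎ c ≡ y ⊎ c ≡ z

  one-of-rotate : ∀ {c x y z} → OneOf c x y z → OneOf c y z x
  one-of-rotate (inj₁ eq) = inj₂ (inj₂ eq)
  one-of-rotate (inj₂ (inj₁ eq)) = inj₁ eq
  one-of-rotate (inj₂ (inj₂ eq)) = inj₂ (inj₁ eq)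

  one-of-swap : ∀ {c x y t} → OneOf c x y t → OneOf c x t y
  one-of-swap (inj₁ eq) = inj₁ eq
  one-of-swap (inj₂ (inj₁ eq)) = inj₂ (inj₂ eq)
  one-of-swap (inj₂ (inj₂ eq)) = inj₂ (inj₁ eq)

  one-of-exhaust : ∀ {x y z c₁ c₂ c₃} → OneOf c₁ x y z → OneOf c₂ x y z → OneOf c₃ x y z →
    c₁ ≢ c₂ → c₁ ≢ c₃ → c₂ ≢ c₃ → OneOf x c₁ c₂ c₃
  one-of-exhaust (inj₁ refl) _ _ _ _ _ = inj₁ refl
  one-of-exhaust _ (inj₁ refl) _ _ _ _ = inj₂ (inj₁ refl)
  one-of-exhaust _ _ (inj₁ refl) _ _ _ = inj₂ (inj₂ refl)
  one-of-exhaust (inj₂ (inj₁ refl)) (inj₂ (inj₁ refl)) _ c₁≢c₂ _ _ = ⊥-elim (c₁≢c₂ refl)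
  one-of-exhaust (inj₂ (inj₂ refl)) (inj₂ (inj₂ refl)) _ c₁≢c₂ _ _ = ⊥-elim (c₁≢c₂ refl)
  one-of-exhaust (inj₂ (inj₁ refl)) _ (inj₂ (inj₁ refl)) _ c₁≢c₃ _ = ⊥-elim (c₁≢c₃ refl)
  one-of-exhaust (inj₂ (inj₂ refl)) _ (inj₂ (inj₂ refl)) _ c₁≢c₃ _ = ⊥-elim (c₁≢c₃ refl)
  one-of-exhaust _ (inj₂ (inj₁ refl)) (inj₂ (inj₁ refl)) _ _ c₂≢c₃ = ⊥-elim (c₂≢c₃ refl)
  one-of-exhaust _ (inj₂ (inj₂ refl)) (inj₂ (inj₂ refl)) _ _ c₂≢c₃ = ⊥-elim (c₂≢c₃ refl)

  one-of-exhaust-all : ∀ {x y z c₁ c₂ c₃} → OneOf c₁ x y z → OneOf c₂ x y z → OneOf c₃ x y z →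
    c₁ ≢ c₂ → c₁ ≢ c₃ → c₂ ≢ c₃ → ∀ c → OneOf c x y z → OneOf c c₁ c₂ c₃
  one-of-exhaust-all h₁ h₂ h₃ c₁≢c₂ c₁≢c₃ c₂≢c₃ c (inj₁ refl) =
    one-of-exhaust h₁ h₂ h₃ c₁≢c₂ c₁≢c₃ c₂≢c₃
  one-of-exhaust-all h₁ h₂ h₃ c₁≢c₂ c₁≢c₃ c₂≢c₃ c (inj₂ (inj₁ refl)) =
    one-of-exhaust (one-of-rotate h₁) (one-of-rotate h₂) (one-of-rotate h₃) c₁≢c₂ c₁≢c₃ c₂≢c₃
  one-of-exhaust-all h₁ h₂ h₃ c₁≢c₂ c₁≢c₃ c₂≢c₃ c (inj₂ (inj₂ refl)) =
    one-of-exhaust (one-of-rotate (one-of-rotate h₁)) (one-of-rotate (one-of-rotate h₂))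
                   (one-of-rotate (one-of-rotate h₃)) c₁≢c₂ c₁≢c₃ c₂≢c₃

  three-not-in-two : ∀ {x₁ x₂ x₃ p q : Fin k} → x₁ ≢ x₂ → x₁ ≢ x₃ → x₂ ≢ x₃ →
    x₁ ≡ p ⊎ x₁ ≡ q → x₂ ≡ p ⊎ x₂ ≡ q → x₃ ≡ p ⊎ x₃ ≡ q → ⊥
  three-not-in-two x₁≢x₂ _ _ (inj₁ refl) (inj₁ refl) _ = x₁≢x₂ refl
  three-not-in-two x₁≢x₂ _ _ (inj₂ refl) (inj₂ refl) _ = x₁≢x₂ refl
  three-not-in-two _ x₁≢x₃ _ (inj₁ refl) _ (inj₁ refl) = x₁≢x₃ refl
  three-not-in-two _ x₁≢x₃ _ (inj₂ refl) _ (inj₂ refl) = x₁≢x₃ refl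
  three-not-in-two _ _ x₂≢x₃ _ (inj₁ refl) (inj₁ refl) = x₂≢x₃ refl
  three-not-in-two _ _ x₂≢x₃ _ (inj₂ refl) (inj₂ refl) = x₂≢x₃ refl

  record ExactlyThree (R : Fin k → Set) : Set where
    constructor exactly-three
    field
      b₁ b₂ b₃ : Fin k
      b₁≢b₂ : b₁ ≢ b₂
      b₁≢b₃ : b₁ ≢ b₃
      b₂≢b₃ : b₂ ≢ b₃
      R-b₁ : R b₁
      R-b₂ : R b₂
      R-b₃ : R b₃
      only : ∀ c → R c → OneOf c b₁ b₂ b₃

  exactly-three-only : ∀ {R} → ExactlyThree R → ∀ {c₁ c₂ c₃} → c₁ ≢ c₂ → c₁ ≢ c₃ → c₂ ≢ c₃ →
    R c₁ → R c₂ → R c₃ → ∀ c → R c → OneOf c c₁ c₂ c₃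
  exactly-three-only (exactly-three _ _ _ _ _ _ _ _ _ only) c₁≢c₂ c₁≢c₃ c₂≢c₃ r₁ r₂ r₃ c r =
    one-of-exhaust-all (only _ r₁) (only _ r₂) (only _ r₃) c₁≢c₂ c₁≢c₃ c₂≢c₃ c (only c r)

  exactly-three-avoiding : ∀ {R} → ExactlyThree R → ∀ p q → Σ (Fin k) λ t → R t × t ≢ p × t ≢ q
  exactly-three-avoiding (exactly-three b₁ b₂ b₃ b₁≢b₂ b₁≢b₃ b₂≢b₃ r₁ r₂ r₃ _) p q
    with b₁ ≟ p | b₁ ≟ q | b₂ ≟ p | b₂ ≟ q | b₃ ≟ p | b₃ ≟ q
  ... | no n₁ | no n₂ | _ | _ | _ | _ = b₁ , r₁ , n₁ , n₂
  ... | _ | _ | no n₁ | no n₂ | _ | _ = b₂ , r₂ , n₁ , n₂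
  ... | _ | _ | _ | _ | no n₁ | no n₂ = b₃ , r₃ , n₁ , n₂
  ... | yes e₁ | _ | yes e₂ | _ | _ | _ = ⊥-elim (b₁≢b₂ (trans e₁ (sym e₂)))
  ... | yes e₁ | _ | _ | _ | yes e₃ | _ = ⊥-elim (b₁≢b₃ (trans e₁ (sym e₃)))
  ... | _ | _ | yes e₂ | _ | yes e₃ | _ = ⊥-elim (b₂≢b₃ (trans e₂ (sym e₃)))
  ... | _ | yes e₁ | _ | yes e₂ | _ | _ = ⊥-elim (b₁≢b₂ (trans e₁ (sym e₂)))
  ... | _ | yes e₁ | _ | _ | _ | yes e₃ = ⊥-elim (b₁≢b₃ (trans e₁ (sym e₃)))
  ... | _ | _ | _ | yes e₂ | _ | yes e₃ = ⊥-elim (b₂≢b₃ (trans e₂ (sym e₃)))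

  -- R stays connected after deleting any set X of at most two letters.
  NoSmallCut : (Fin k → Fin k → Set) → Set₁
  NoSmallCut R = ∀ (C : Fin k → Set) (X : List (Fin k)) → length X ≤ 2 →
    (∀ a b → C a → R a b → C b ⊎ b ∈ X) →
    ∀ a b → C a → ¬ C b → a ∉ X → b ∉ X → ⊥

  TwinsOf : (Fin k → Fin k → Set) → Fin k → Fin k → Set
  TwinsOf R x y = x ≢ y × (∀ c → c ≢ x → c ≢ y → (R x c → R y c) × (R y c → R x c))

  TwoDisjointTwins : (Fin k → Fin k → Set) → Set
  TwoDisjointTwins R = Σ (Fin k) λ v₁ → Σ (Fin k) λ v₂ → Σ (Fin k) λ v₃ → Σ (Fin k) λ v₄ →
    TwinsOf R v₁ v₂ × TwinsOf R v₃ v₄ × v₁ ≢ v₃ × v₁ ≢ v₄ × v₂ ≢ v₃ × v₂ ≢ v₄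

  -- The word of a cubic, 3-connected circle graph without two disjoint twin pairs.
  record Counterexample (w : Word k) : Set₁ where
    field
      double : ∀ a → occ a w ≡ 2
      cubic : ∀ a → ExactlyThree (Interlaced w a)
      no-small-cut : NoSmallCut (Interlaced w)
      no-twins : ¬ TwoDisjointTwins (Interlaced w)

  module _ {R R′ : Fin k → Fin k → Set} (to : ∀ a b → R a b → R′ a b) (from : ∀ a b → R′ a b → R a b) where

    exactly-three-transport : ∀ {a} → ExactlyThree (R a) → ExactlyThree (R′ a)
    exactly-three-transport (exactly-three b₁ b₂ b₃ b₁≢b₂ b₁≢b₃ b₂≢b₃ r₁ r₂ r₃ only) =
      exactly-three b₁ b₂ b₃ b₁≢b₂ b₁≢b₃ b₂≢b₃ (to _ _ r₁) (to _ _ r₂) (to _ _ r₃) (λ c r → only c (from _ _ r))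

    no-small-cut-transport : NoSmallCut R → NoSmallCut R′
    no-small-cut-transport no-cut C X ∣X∣≤2 closed = no-cut C X ∣X∣≤2 (λ a b c r → closed a b c (to a b r))

    twins-transport : ∀ {x y} → TwinsOf R x y → TwinsOf R′ x y
    twins-transport (x≢y , same) = x≢y , λ c c≢x c≢y →
      (λ r → to _ _ (proj₁ (same c c≢x c≢y) (from _ _ r))) , (λ r → to _ _ (proj₂ (same c c≢x c≢y) (from _ _ r)))

  two-disjoint-twins-transport : ∀ {R R′ : Fin k → Fin k → Set} →
    (∀ a b → R a b → R′ a b) → (∀ a b → R′ a b → R a b) → TwoDisjointTwins R → TwoDisjointTwins R′
  two-disjoint-twins-transport to from (v₁ , v₂ , v₃ , v₄ , t₁₂ , t₃₄ , distinct) =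
    v₁ , v₂ , v₃ , v₄ , twins-transport to from t₁₂ , twins-transport to from t₃₄ , distinct

  -- Interlacement only depends on the word up to rotation: it is a property of the circle.
  record Rotation (w w′ : Word k) : Set where
    constructor rotation
    field
      u v : Word k
      w≡ : w ≡ u ++ v
      w′≡ : w′ ≡ v ++ u

  rotation-sym : ∀ {w w′} → Rotation w w′ → Rotation w′ w
  rotation-sym (rotation u v w≡ w′≡) = rotation v u w′≡ w≡

  interlaced-rotation : ∀ {w w′} → Rotation w w′ → ∀ a b → Interlaced w a b → Interlaced w′ a b
  interlaced-rotation (rotation u v refl refl) = interlaced-rotate u v

  chord-to-front : ∀ {w} z (P S Q : Word k) → w ≡ P ++ z ∷ S ++ z ∷ Q → Rotation w (z ∷ S ++ z ∷ (Q ++ P))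
  chord-to-front z P S Q w≡ = rotation P (z ∷ S ++ z ∷ Q) w≡ (cong (z ∷_) (sym (++-assoc S (z ∷ Q) P)))

  chord-to-back : ∀ {w} z (P S Q : Word k) → w ≡ P ++ z ∷ S ++ z ∷ Q → Rotation w (z ∷ (Q ++ P) ++ z ∷ S)
  chord-to-back z P S Q w≡ =
    rotation (P ++ z ∷ S) (z ∷ Q) (trans w≡ (sym (++-assoc P (z ∷ S) (z ∷ Q)))) (cong (z ∷_) (++-assoc Q P (z ∷ S)))

  occ-rotation : ∀ {w w′} → Rotation w w′ → ∀ a → occ a w′ ≡ occ a w
  occ-rotation (rotation u v refl refl) a = trans (occ-++ a v u) (trans (+-comm (occ a v) (occ a u)) (sym (occ-++ a u v)))

  counterexample-rotation : ∀ {w w′} → Rotation w w′ → Counterexample w → Counterexample w′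
  counterexample-rotation {w} {w′} rot ce = record
    { double = λ a → trans (occ-rotation rot a) (double a)
    ; cubic = λ a → exactly-three-transport to from (cubic a)
    ; no-small-cut = no-small-cut-transport to from no-small-cut
    ; no-twins = λ twins → no-twins (two-disjoint-twins-transport from to twins)
    }
    where
    open Counterexample ce
    to : ∀ a b → Interlaced w a b → Interlaced w′ a b
    to = interlaced-rotation rot
    from : ∀ a b → Interlaced w′ a b → Interlaced w a b
    from = interlaced-rotation (rotation-sym rot)

module _ {k : ℕ} where

  occ-triple≡1 : ∀ {c b₁ b₂ b₃ : Fin k} → b₁ ≢ b₂ → b₁ ≢ b₃ → b₂ ≢ b₃ → OneOf c b₁ b₂ b₃ →
    occ c (b₁ ∷ b₂ ∷ b₃ ∷ []) ≡ 1
  occ-triple≡1 b₁≢b₂ b₁≢b₃ b₂≢b₃ (inj₁ refl) = occ-once [] (_ ∷ _ ∷ []) [] (b₁≢b₂ ∷ b₁≢b₃ ∷ [])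
  occ-triple≡1 b₁≢b₂ b₁≢b₃ b₂≢b₃ (inj₂ (inj₁ refl)) =
    occ-once (_ ∷ []) (_ ∷ []) (≢-sym b₁≢b₂ ∷ []) (b₂≢b₃ ∷ [])
  occ-triple≡1 b₁≢b₂ b₁≢b₃ b₂≢b₃ (inj₂ (inj₂ refl)) =
    occ-once (_ ∷ _ ∷ []) [] (≢-sym b₁≢b₃ ∷ ≢-sym b₂≢b₃ ∷ []) []

  occ-triple≡1⇒one-of : ∀ c (b₁ b₂ b₃ : Fin k) → occ c (b₁ ∷ b₂ ∷ b₃ ∷ []) ≡ 1 → OneOf c b₁ b₂ b₃
  occ-triple≡1⇒one-of c b₁ b₂ b₃ occ≡1 with c ≟ b₁ | c ≟ b₂ | c ≟ b₃
  ... | yes eq | _ | _ = inj₁ eq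
  ... | no _ | yes eq | _ = inj₂ (inj₁ eq)
  ... | no _ | no _ | yes eq = inj₂ (inj₂ eq)
  ... | no c≢b₁ | no c≢b₂ | no c≢b₃ =
    ⊥-elim (0≢1+n (trans (sym (occ-∉ (b₁ ∷ b₂ ∷ b₃ ∷ []) (c≢b₁ ∷ c≢b₂ ∷ c≢b₃ ∷ []))) occ≡1))

module InCounterexample {k} {w : Word k} (ce : Counterexample w) where
  open Counterexample ce public

  occ-infix≤2 : ∀ (A X C : Word k) → w ≡ A ++ X ++ C → ∀ c → occ c X ≤ 2
  occ-infix≤2 A X C refl c = ≤-trans (occ-infix-≤ c A X C) (≤-reflexive (double c))

  chord-at : ∀ a (P B Q : Word k) → w ≡ P ++ a ∷ B ++ a ∷ Q → Chord a w
  chord-at a P B Q w≡ = chord P B Q w≡ (proj₁ counts) (proj₁ (proj₂ counts)) (proj₂ (proj₂ counts))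
    where
    counts : occ a P ≡ 0 × occ a B ≡ 0 × occ a Q ≡ 0
    counts = chord-counts (occ a P) (occ a B) (occ a Q)
      (trans (sym (occ-chord-≡ a P B Q)) (trans (cong (occ a) (sym w≡)) (double a)))

  chord-of-letter : ∀ a → Chord a w
  chord-of-letter a = chord-of a w (double a)

  interlaced-irrefl : ∀ a → ¬ Interlaced w a a
  interlaced-irrefl a = chord-irrefl (chord-of-letter a)

  inside≡1⇒interlaced : ∀ {a b} (ch : Chord a w) → occ b (Chord.B ch) ≡ 1 → Interlaced w a b
  inside≡1⇒interlaced ch = occ-inside≡1⇒interlaced ch (double _)

  -- The letters occurring once inside the chord of a are its three neighbours.
  #once-inside≡3 : ∀ {a} (ch : Chord a w) → #once (Chord.B ch) ≡ 3
  #once-inside≡3 {a} ch = trans (sum-cong-≗ pointwise) (sum-occ (b₁ ∷ b₂ ∷ b₃ ∷ []))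
    where
    open ExactlyThree (cubic a)
    pointwise : ∀ c → indicator (occ c (Chord.B ch) ℕ.≟ 1) ≡ occ c (b₁ ∷ b₂ ∷ b₃ ∷ [])
    pointwise c with occ c (Chord.B ch) ℕ.≟ 1
    ... | yes once = sym (occ-triple≡1 {c = c} b₁≢b₂ b₁≢b₃ b₂≢b₃ (only c (inside≡1⇒interlaced ch once)))
    ... | no ¬once = sym (occ-∉ (b₁ ∷ b₂ ∷ b₃ ∷ []) (not-neighbour R-b₁ ∷ not-neighbour R-b₂ ∷ not-neighbour R-b₃ ∷ []))
      where
      not-neighbour : ∀ {b} → Interlaced w a b → c ≢ b
      not-neighbour int refl = ¬once (interlaced⇒occ-inside≡1 ch int)

  -- The letters occurring once in I separate those occurring twice in I from the others.
  no-small-cut-infix : ∀ (A I C : Word k) → w ≡ A ++ I ++ C → #once I ≤ 2 →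
    ∀ a → occ a I ≡ 2 → ∀ b → occ b I ≡ 0 → ⊥
  no-small-cut-infix A I C w≡ #once≤2 a a-twice b b-absent =
    no-small-cut (λ c → occ c I ≡ 2) once-letters ∣once-letters∣≤2 closed a b a-twice
      (λ b-twice → 0≢1+n (trans (sym b-absent) b-twice))
      (λ a∈ → 1≢2 (trans (sym (once a∈)) a-twice))
      (λ b∈ → 0≢1+n (trans (sym b-absent) (once b∈)))
    where
    once-letters : List (Fin k)
    once-letters = filter (λ c → occ c I ℕ.≟ 1) (allFin k)
    ∣once-letters∣≤2 : length once-letters ≤ 2
    ∣once-letters∣≤2 = ≤-trans (≤-reflexive (length-filter-tabulate (λ c → occ c I ℕ.≟ 1) id)) #once≤2
    once : ∀ {c} → c ∈ once-letters → occ c I ≡ 1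
    once c∈ = proj₂ (∈-filter⁻ (λ c → occ c I ℕ.≟ 1) {xs = allFin k} c∈)
    1≢2 : 1 ≢ 2
    1≢2 ()
    closed : ∀ y c → occ y I ≡ 2 → Interlaced w y c → occ c I ≡ 2 ⊎ c ∈ once-letters
    closed y c y-twice int with chord-of y I y-twice
    ... | chord I₁ I₂ I₃ refl _ _ _ = by-count (occ c I) refl
      where
      w≡′ : w ≡ (A ++ I₁) ++ y ∷ I₂ ++ y ∷ (I₃ ++ C)
      w≡′ = trans w≡ (++-assoc-chord A I₁ y I₂ I₃ C)
      present : 1 ≤ occ c I
      present = ≤-trans (≤-reflexive (sym (interlaced⇒occ-inside≡1 (chord-at y _ I₂ _ w≡′) int)))
                        (occ-inside-≤ c y I₁ I₂ I₃)
      by-count : ∀ m → occ c I ≡ m → occ c I ≡ 2 ⊎ c ∈ once-letters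
      by-count zero eq = ⊥-elim (<⇒≱ present (≤-reflexive eq))
      by-count (suc zero) eq = inj₂ (∈-filter⁺ (λ c → occ c I ℕ.≟ 1) (∈-allFin c) eq)
      by-count (suc (suc zero)) eq = inj₁ eq
      by-count (suc (suc (suc _))) eq = ⊥-elim (<⇒≱ (≤-trans (s≤s (s≤s (s≤s z≤n))) (≤-reflexive (sym eq)))
                                                     (occ-infix≤2 A I C w≡ c))

module ChordInterior {k} {w : Word k} (ce : Counterexample w) (z : Fin k) (P S Q : Word k)
  (w≡ : w ≡ P ++ z ∷ S ++ z ∷ Q) where
  open InCounterexample ce

  z-chord : Chord z w
  z-chord = chord-at z P S Q w≡

  z∉S : occ z S ≡ 0
  z∉S = Chord.occ-B z-chord

  #once-S≡3 : #once S ≡ 3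
  #once-S≡3 = #once-inside≡3 z-chord

  occ-S≤2 : ∀ c → occ c S ≤ 2
  occ-S≤2 = occ-infix≤2 (P ++ z ∷ []) S (z ∷ Q) (trans w≡ (sym (++-assoc P (z ∷ []) _)))

  length-S : length S ≡ 3 + 2 * #twice S
  length-S = trans (length≡#once+2*#twice S occ-S≤2) (cong (_+ 2 * #twice S) #once-S≡3)

  occ-S≡2 : ∀ c → 2 ≤ occ c S → occ c S ≡ 2
  occ-S≡2 c = ≤-antisym (occ-S≤2 c)

  occ-infix≤2-S : ∀ (A I C : Word k) → S ≡ A ++ I ++ C → ∀ c → occ c I ≤ 2
  occ-infix≤2-S A I C S≡ c = ≤-trans (occ-infix-≤ c A I C) (≤-trans (≤-reflexive (cong (occ c) (sym S≡))) (occ-S≤2 c))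

  occ-infix-S≡2 : ∀ (A I C : Word k) → S ≡ A ++ I ++ C → ∀ c → 2 ≤ occ c I → occ c I ≡ 2
  occ-infix-S≡2 A I C S≡ c 2≤ = ≤-antisym (occ-infix≤2-S A I C S≡ c) 2≤

  chord-in-S : ∀ y (S₁ B S₂ : Word k) → S ≡ S₁ ++ y ∷ B ++ y ∷ S₂ →
    w ≡ (P ++ z ∷ S₁) ++ y ∷ B ++ y ∷ (S₂ ++ z ∷ Q)
  chord-in-S y S₁ B S₂ S≡ = trans w≡ (trans (cong (λ t → P ++ z ∷ t ++ z ∷ Q) S≡)
    (trans (cong (λ t → P ++ z ∷ t) (++-assoc-chord [] S₁ y B S₂ (z ∷ Q))) (sym (++-assoc P (z ∷ S₁) _))))

  no-small-cut-in-S : ∀ (A I C : Word k) → S ≡ A ++ I ++ C → #once I ≤ 2 → ∀ a → occ a I ≡ 2 → ⊥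
  no-small-cut-in-S A I C S≡ #once≤2 a a-twice =
    no-small-cut-infix (P ++ z ∷ A) I (C ++ z ∷ Q) w≡′ #once≤2 a a-twice z
      (n≤0⇒n≡0 (≤-trans (occ-infix-≤ z A I C) (≤-reflexive (trans (cong (occ z) (sym S≡)) z∉S))))
    where
    w≡′ : w ≡ (P ++ z ∷ A) ++ I ++ (C ++ z ∷ Q)
    w≡′ = trans w≡ (trans (cong (λ t → P ++ z ∷ t ++ z ∷ Q) S≡)
      (trans (cong (λ t → P ++ z ∷ t) (trans (++-assoc A (I ++ C) _) (cong (A ++_) (++-assoc I C _))))
             (sym (++-assoc P (z ∷ A) _))))

-- Innermost chords

NoNestedChords : ∀ {k} → Word k → Set
NoNestedChords {k} S = ∀ y (S₁ B S₂ : Word k) → S ≡ S₁ ++ y ∷ B ++ y ∷ S₂ → ∀ c → occ c B ≤ 1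

record FrontChord {k} (S : Word k) : Set where
  constructor front-chord
  field
    u b₁ b₂ b₃ : Fin k
    R : Word k
    S≡ : S ≡ u ∷ b₁ ∷ b₂ ∷ b₃ ∷ u ∷ R

record BackChord {k} (S : Word k) : Set where
  constructor back-chord
  field
    L : Word k
    v c₁ c₂ c₃ : Fin k
    S≡ : S ≡ L ++ v ∷ c₁ ∷ c₂ ∷ c₃ ∷ v ∷ []

data InnermostShape {k} (S : Word k) : Set where
  one-chord : ∀ u b₁ b₂ b₃ → S ≡ u ∷ b₁ ∷ b₂ ∷ b₃ ∷ u ∷ [] → InnermostShape S
  two-chords : ∀ u a v b c → S ≡ u ∷ a ∷ v ∷ b ∷ u ∷ c ∷ v ∷ [] → InnermostShape S

module InnermostInterior {k} {w : Word k} (ce : Counterexample w) (z : Fin k) (P S Q : Word k)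
  (w≡ : w ≡ P ++ z ∷ S ++ z ∷ Q) (nested : NoNestedChords S) where
  open InCounterexample ce
  open ChordInterior ce z P S Q w≡

  inside-length≡3 : ∀ y (S₁ B S₂ : Word k) → S ≡ S₁ ++ y ∷ B ++ y ∷ S₂ → length B ≡ 3
  inside-length≡3 y S₁ B S₂ S≡ = begin
      length B
    ≡⟨ length≡#once+2*#twice B (λ c → ≤-trans (nested y S₁ B S₂ S≡ c) (n≤1+n 1)) ⟩
      #once B + 2 * #twice B
    ≡⟨ cong₂ (λ m n → m + 2 * n) (#once-inside≡3 (chord-at y _ B _ (chord-in-S y S₁ B S₂ S≡)))
                                 (#twice≡0 B (nested y S₁ B S₂ S≡)) ⟩
      3
    ∎
    where open ≡-Reasoning

  private
    length≡3 : ∀ (B : Word k) → length B ≡ 3 → Σ (Fin k) λ x → Σ (Fin k) λ y → Σ (Fin k) λ t → B ≡ x ∷ y ∷ t ∷ []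
    length≡3 (x ∷ y ∷ t ∷ []) _ = x , y , t , refl

    occ-S≱3 : ∀ c → 3 ≤ occ c S → ⊥
    occ-S≱3 c 3≤ = <⇒≱ 3≤ (occ-S≤2 c)

  -- A letter occurring once at an end of S would leave a small cut of the rest.
  chord-at-front : ∀ a → occ a S ≡ 2 → FrontChord S
  chord-at-front a a-twice = front S refl
    where
    front : ∀ S′ → S ≡ S′ → FrontChord S
    front [] S≡ = ⊥-elim (0≢1+n (trans (sym (cong (occ a) S≡)) a-twice))
    front (s ∷ rest) S≡ with occ s rest in s-in-rest
    ... | zero = ⊥-elim (no-small-cut-in-S (s ∷ []) rest [] (trans S≡ (cong (s ∷_) (sym (++-identityʳ rest))))
                           (≤-reflexive #once-rest≡2) a a-in-rest)
      where
      #once-rest≡2 : #once rest ≡ 2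
      #once-rest≡2 = suc-injective (trans (sym (#once-insert s [] rest s-in-rest)) (trans (cong #once (sym S≡)) #once-S≡3))
      a≢s : a ≢ s
      a≢s refl with () ← trans (sym (trans (cong (occ a) S≡) (trans (occ-head a rest) (cong suc s-in-rest)))) a-twice
      a-in-rest : occ a rest ≡ 2
      a-in-rest = trans (sym (occ-∷-≢ rest (≢-sym a≢s))) (trans (cong (occ a) (sym S≡)) a-twice)
    ... | suc zero with split-at-first s 0 rest s-in-rest
    ...   | B , R , refl , _ , _ with length≡3 B (inside-length≡3 s [] B R S≡)
    ...     | b₁ , b₂ , b₃ , refl = front-chord s b₁ b₂ b₃ R S≡
    front (s ∷ rest) S≡ | suc (suc n) = ⊥-elim (occ-S≱3 s (≤-trans (s≤s (s≤s (s≤s z≤n)))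
      (≤-reflexive (sym (trans (cong (occ s) S≡) (trans (occ-head s rest) (cong suc s-in-rest)))))))

  chord-at-back : ∀ a → occ a S ≡ 2 → BackChord S
  chord-at-back a a-twice = back S refl
    where
    back : ∀ S′ → S ≡ S′ → BackChord S
    back S′ S≡ with initLast S′
    ... | [] = ⊥-elim (0≢1+n (trans (sym (cong (occ a) S≡)) a-twice))
    ... | L ∷ʳ′ x with occ x L in x-in-L
    ...   | zero = ⊥-elim (no-small-cut-in-S [] L (x ∷ []) S≡ (≤-reflexive #once-L≡2) a a-in-L)
      where
      occ-x-S : occ x S ≡ occ x L + 1
      occ-x-S = trans (cong (occ x) S≡) (trans (occ-++ x L (x ∷ [])) (cong (occ x L +_) (occ-head x [])))
      #once-L≡2 : #once L ≡ 2
      #once-L≡2 = trans (cong #once (sym (++-identityʳ L))) (suc-injective (trans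
        (sym (#once-insert x L [] (trans (cong (occ x) (++-identityʳ L)) x-in-L)))
        (trans (cong #once (sym S≡)) #once-S≡3)))
      a≢x : a ≢ x
      a≢x refl with () ← trans (sym (trans occ-x-S (cong (_+ 1) x-in-L))) a-twice
      a-in-L : occ a L ≡ 2
      a-in-L = trans (sym (occ-∷ʳ-≢ L (≢-sym a≢x))) (trans (cong (occ a) (sym S≡)) a-twice)
    ...   | suc zero with split-at-first x 0 L x-in-L
    ...     | L₀ , B , refl , _ , _ with length≡3 B (inside-length≡3 x L₀ B [] (trans S≡ (++-assoc L₀ (x ∷ B) _)))
    ...       | c₁ , c₂ , c₃ , refl = back-chord L₀ x c₁ c₂ c₃ (trans S≡ (++-assoc L₀ (x ∷ c₁ ∷ c₂ ∷ c₃ ∷ []) _))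
    back S′ S≡ | L ∷ʳ′ x | suc (suc n) = ⊥-elim (occ-S≱3 x (≤-trans (s≤s (s≤s (s≤s z≤n)))
      (≤-reflexive (sym (trans (cong (occ x) S≡) (trans (occ-++ x L (x ∷ [])) (trans (cong₂ _+_ x-in-L (occ-head x [])) (+-comm _ 1))))))))

  -- Every chord inside S spans exactly five consecutive letters.
  occ-window≤1 : ∀ (A Y C : Word k) → S ≡ A ++ Y ++ C → length Y ≤ 4 → ∀ c → occ c Y ≤ 1
  occ-window≤1 A Y C S≡ ∣Y∣≤4 c with occ c Y in c-in-Y
  ... | zero = z≤n
  ... | suc zero = ≤-refl
  ... | suc (suc n) with split-at-first c (suc n) Y c-in-Y
  ...   | Y₁ , R , refl , _ , c-in-R with split-at-first c n R c-in-R
  ...     | M , Y₃ , refl , _ , _ = ⊥-elim (<⇒≱ 5≤∣Y∣ ∣Y∣≤4)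
    where
    ∣M∣≡3 : length M ≡ 3
    ∣M∣≡3 = inside-length≡3 c (A ++ Y₁) M (Y₃ ++ C) (trans S≡ (++-assoc-chord A Y₁ c M Y₃ C))
    5≤∣Y∣ : 5 ≤ length (Y₁ ++ c ∷ M ++ c ∷ Y₃)
    5≤∣Y∣ = begin
      5                                      ≡⟨ cong (λ t → suc (suc t)) (sym ∣M∣≡3) ⟩
      suc (suc (length M))                   ≤⟨ s≤s (m≤m+n (suc (length M)) (length Y₃)) ⟩
      suc (suc (length M + length Y₃))       ≡⟨ cong suc (sym (+-suc (length M) (length Y₃))) ⟩
      suc (length M + suc (length Y₃))       ≤⟨ m≤n+m _ (length Y₁) ⟩
      length Y₁ + suc (length M + suc (length Y₃))
        ≡⟨ sym (trans (length-++ Y₁) (cong (λ t → length Y₁ + suc t) (length-++ M))) ⟩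
      length (Y₁ ++ c ∷ M ++ c ∷ Y₃)         ∎
      where open ≤-Reasoning

  occ-outside-window : ∀ (X Y Z : Word k) → S ≡ X ++ Y ++ Z → 4 ≤ length Y → ∀ c → occ c X ≡ 0 ⊎ occ c Z ≡ 0
  occ-outside-window X Y Z S≡ 4≤∣Y∣ c with occ c X in c-in-X | occ c Z in c-in-Z
  ... | zero | _ = inj₁ refl
  ... | suc _ | zero = inj₂ refl
  ... | suc m | suc n with split-at-first c m X c-in-X | split-at-first c n Z c-in-Z
  ...   | X₁ , X₂ , refl , _ , _ | Z₁ , Z₂ , refl , _ , _ = ⊥-elim (<⇒≱ 4≤∣inside∣ (≤-reflexive ∣inside∣≡3))
    where
    inside : Word k
    inside = X₂ ++ Y ++ Z₁
    S≡′ : S ≡ X₁ ++ c ∷ inside ++ c ∷ Z₂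
    S≡′ = begin
      S                                        ≡⟨ S≡ ⟩
      (X₁ ++ c ∷ X₂) ++ Y ++ Z₁ ++ c ∷ Z₂      ≡⟨ ++-assoc X₁ (c ∷ X₂) _ ⟩
      X₁ ++ c ∷ X₂ ++ Y ++ Z₁ ++ c ∷ Z₂        ≡⟨ cong (λ t → X₁ ++ c ∷ X₂ ++ t) (sym (++-assoc Y Z₁ (c ∷ Z₂))) ⟩
      X₁ ++ c ∷ X₂ ++ (Y ++ Z₁) ++ c ∷ Z₂      ≡⟨ cong (λ t → X₁ ++ c ∷ t) (sym (++-assoc X₂ (Y ++ Z₁) (c ∷ Z₂))) ⟩
      X₁ ++ c ∷ inside ++ c ∷ Z₂               ∎
      where open ≡-Reasoning
    ∣inside∣≡3 : length inside ≡ 3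
    ∣inside∣≡3 = inside-length≡3 c X₁ inside Z₂ S≡′
    4≤∣inside∣ : 4 ≤ length inside
    4≤∣inside∣ = ≤-trans 4≤∣Y∣ (length-infix-≤ X₂ Y Z₁)

  #twice-overlap : ∀ (X Y Z : Word k) → S ≡ X ++ Y ++ Z → length Y ≡ 4 →
    #twice S ≡ #twice (X ++ Y) + #twice (Y ++ Z)
  #twice-overlap X Y Z S≡ ∣Y∣≡4 =
    trans (sum-cong-≗ pointwise) (∑-distrib-+ (twice (X ++ Y)) (twice (Y ++ Z)))
    where
    twice : Word k → Fin k → ℕ
    twice V c = indicator (occ c V ℕ.≟ 2)
    twice-≤1 : ∀ V c → occ c V ≤ 1 → twice V c ≡ 0
    twice-≤1 V c ≤1 = indicator-no (occ c V ℕ.≟ 2) (λ eq → <⇒≱ (s≤s (s≤s z≤n)) (subst (_≤ 1) eq ≤1))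
    occ-Y≤1 : ∀ c → occ c Y ≤ 1
    occ-Y≤1 = occ-window≤1 X Y Z S≡ (≤-reflexive ∣Y∣≡4)
    pointwise : ∀ c → twice S c ≡ twice (X ++ Y) c + twice (Y ++ Z) c
    pointwise c with occ-outside-window X Y Z S≡ (≤-reflexive (sym ∣Y∣≡4)) c
    ... | inj₁ c∉X = trans (cong (λ t → indicator (t ℕ.≟ 2)) occ-S≡)
                           (cong (_+ twice (Y ++ Z) c) (sym (twice-≤1 (X ++ Y) c XY≤1)))
      where
      occ-S≡ : occ c S ≡ occ c (Y ++ Z)
      occ-S≡ = trans (cong (occ c) S≡) (trans (occ-++ c X (Y ++ Z)) (cong (_+ occ c (Y ++ Z)) c∉X))
      XY≤1 : occ c (X ++ Y) ≤ 1
      XY≤1 = ≤-trans (≤-reflexive (trans (occ-++ c X Y) (cong (_+ occ c Y) c∉X))) (occ-Y≤1 c)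
    ... | inj₂ c∉Z = trans (cong (λ t → indicator (t ℕ.≟ 2)) occ-S≡)
                           (trans (sym (+-identityʳ _)) (cong (twice (X ++ Y) c +_) (sym (twice-≤1 (Y ++ Z) c YT≤1))))
      where
      occ-S≡ : occ c S ≡ occ c (X ++ Y)
      occ-S≡ = trans (cong (occ c) (trans S≡ (sym (++-assoc X Y Z))))
                     (trans (occ-++ c (X ++ Y) Z) (trans (cong (occ c (X ++ Y) +_) c∉Z) (+-identityʳ _)))
      YT≤1 : occ c (Y ++ Z) ≤ 1
      YT≤1 = ≤-trans (≤-reflexive (trans (occ-++ c Y Z) (trans (cong (occ c Y +_) c∉Z) (+-identityʳ _)))) (occ-Y≤1 c)

  #once-overlap : ∀ (X Y Z : Word k) → S ≡ X ++ Y ++ Z → length X ≡ 4 → length Y ≡ 4 →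
    #once (X ++ Y) + #once (Y ++ Z) ≡ 7
  #once-overlap X Y Z S≡ ∣X∣≡4 ∣Y∣≡4 =
    once-overlap-arith (#once (X ++ Y)) (#once (Y ++ Z)) (#twice (X ++ Y)) (#twice (Y ++ Z)) (length (Y ++ Z))
    (trans (sym (length≡#once+2*#twice (X ++ Y) (occ-infix≤2-S [] (X ++ Y) Z (trans S≡ (sym (++-assoc X Y Z))))))
           (trans (length-++ X) (cong₂ _+_ ∣X∣≡4 ∣Y∣≡4)))
    (sym (length≡#once+2*#twice (Y ++ Z) (occ-infix≤2-S X (Y ++ Z) [] (trans S≡ (cong (X ++_) (sym (++-identityʳ _)))))))
    (begin
      4 + length (Y ++ Z)             ≡⟨ cong (_+ length (Y ++ Z)) (sym ∣X∣≡4) ⟩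
      length X + length (Y ++ Z)      ≡⟨ sym (length-++ X) ⟩
      length (X ++ Y ++ Z)            ≡⟨ cong length (sym S≡) ⟩
      length S                        ≡⟨ length-S ⟩
      3 + 2 * #twice S                ≡⟨ cong (λ t → 3 + 2 * t) (#twice-overlap X Y Z S≡ ∣Y∣≡4) ⟩
      3 + 2 * (#twice (X ++ Y) + #twice (Y ++ Z)) ∎)
    where open ≡-Reasoning

  -- X Y and Y Z share seven once-letters; by parity either X Y has at most two, or the end of Y Z
  -- after u has at most two: a small cut either way.
  no-long-interior : ∀ u b₁ b₂ b₃ r₁ r₂ r₃ r₄ r₅ R →
    S ≡ u ∷ b₁ ∷ b₂ ∷ b₃ ∷ u ∷ r₁ ∷ r₂ ∷ r₃ ∷ r₄ ∷ r₅ ∷ R →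
    ∀ L v c₁ c₂ c₃ → r₁ ∷ r₂ ∷ r₃ ∷ r₄ ∷ r₅ ∷ R ≡ L ++ v ∷ c₁ ∷ c₂ ∷ c₃ ∷ v ∷ [] → ⊥
  no-long-interior u b₁ b₂ b₃ r₁ r₂ r₃ r₄ r₅ R S≡ L v c₁ c₂ c₃ D≡ = small-cut
    where
    X Y Z D U : Word k
    X = u ∷ b₁ ∷ b₂ ∷ b₃ ∷ []
    Y = u ∷ r₁ ∷ r₂ ∷ r₃ ∷ []
    Z = r₄ ∷ r₅ ∷ R
    D = r₁ ∷ r₂ ∷ r₃ ∷ r₄ ∷ r₅ ∷ R
    U = u ∷ b₁ ∷ b₂ ∷ b₃ ∷ u ∷ []
    S≡′ : S ≡ U ++ D ++ []
    S≡′ = trans S≡ (cong (U ++_) (sym (++-identityʳ D)))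
    u-twice-XY : occ u (X ++ Y) ≡ 2
    u-twice-XY = occ-infix-S≡2 [] (X ++ Y) Z S≡ u (occ-chord-≥2 u [] (b₁ ∷ b₂ ∷ b₃ ∷ []) (r₁ ∷ r₂ ∷ r₃ ∷ []))
    v-twice-D : occ v D ≡ 2
    v-twice-D = occ-infix-S≡2 U D [] S≡′ v (subst (λ t → 2 ≤ occ v t) (sym D≡) (occ-chord-≥2 v L (c₁ ∷ c₂ ∷ c₃ ∷ []) []))
    u∉D : occ u D ≡ 0
    u∉D = n≤0⇒n≡0 (≤-trans (occ-++ˡ-≤ u D (z ∷ Q))
      (≤-reflexive (Chord.occ-Q (chord-at u _ (b₁ ∷ b₂ ∷ b₃ ∷ []) _ (chord-in-S u [] (b₁ ∷ b₂ ∷ b₃ ∷ []) D S≡)))))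
    length-XY : #once (X ++ Y) + 2 * #twice (X ++ Y) ≡ 8
    length-XY = sym (length≡#once+2*#twice (X ++ Y) (occ-infix≤2-S [] (X ++ Y) Z S≡))
    #once-sum : #once (X ++ Y) + #once (u ∷ D) ≡ 7
    #once-sum = #once-overlap X Y Z S≡ refl refl
    #once-XY≢3 : #once (X ++ Y) ≢ 3
    #once-XY≢3 eq with () ← trans (sym (3+2*-odd (#twice (X ++ Y))))
                                  (cong (_% 2) (trans (cong (_+ 2 * #twice (X ++ Y)) (sym eq)) length-XY))
    #once-D≤2 : ¬ #once (X ++ Y) ≤ 2 → #once D ≤ 2
    #once-D≤2 #once-XY≰2 = ≤-pred (+-cancelˡ-≤ 4 _ _ (begin
      4 + suc (#once D)              ≡⟨ cong (4 +_) (sym (#once-insert u [] D u∉D)) ⟩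
      4 + #once (u ∷ D)              ≤⟨ +-monoˡ-≤ _ 4≤#once-XY ⟩
      #once (X ++ Y) + #once (u ∷ D) ≡⟨ #once-sum ⟩
      7                              ∎))
      where
      open ≤-Reasoning
      4≤#once-XY : 4 ≤ #once (X ++ Y)
      4≤#once-XY with m≤n⇒m<n∨m≡n (≰⇒> #once-XY≰2)
      ... | inj₁ 3<#once = 3<#once
      ... | inj₂ 3≡#once = ⊥-elim (#once-XY≢3 (sym 3≡#once))
    small-cut : ⊥
    small-cut with #once (X ++ Y) ℕ.≤? 2
    ... | yes #once-XY≤2 = no-small-cut-in-S [] (X ++ Y) Z S≡ #once-XY≤2 u u-twice-XY
    ... | no #once-XY≰2 = no-small-cut-in-S U D [] S≡′ (#once-D≤2 #once-XY≰2) v v-twice-D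

  innermost-shape : ∀ a → occ a S ≡ 2 → InnermostShape S
  innermost-shape a a-twice with chord-at-front a a-twice | chord-at-back a a-twice
  ... | front-chord u b₁ b₂ b₃ R S≡₁ | back-chord L v c₁ c₂ c₃ S≡₂ = classify R L S≡₁ S≡₂ ∣L∣≡∣R∣
    where
    ∣L∣≡∣R∣ : length L ≡ length R
    ∣L∣≡∣R∣ = +-cancelʳ-≡ 5 _ _ (trans (sym (length-++ L)) (trans (cong length (trans (sym S≡₂) S≡₁)) (+-comm 5 (length R))))
    odd : ∀ {V : Word k} → S ≡ V → length V % 2 ≡ 1
    odd S≡ = trans (cong (λ t → length t % 2) (sym S≡)) (trans (cong (_% 2) length-S) (3+2*-odd (#twice S)))
    classify : ∀ R L → S ≡ u ∷ b₁ ∷ b₂ ∷ b₃ ∷ u ∷ R → S ≡ L ++ v ∷ c₁ ∷ c₂ ∷ c₃ ∷ v ∷ [] →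
      length L ≡ length R → InnermostShape S
    classify [] [] S≡₁ _ _ = one-chord u b₁ b₂ b₃ S≡₁
    classify (_ ∷ []) (_ ∷ []) S≡₁ _ _ with () ← odd S≡₁
    classify (r₁ ∷ _ ∷ []) (_ ∷ _ ∷ []) S≡₁ S≡₂ _ with trans (sym S≡₁) S≡₂
    ... | refl = two-chords u b₁ b₂ b₃ r₁ S≡₁
    classify (_ ∷ _ ∷ _ ∷ []) (_ ∷ _ ∷ _ ∷ []) S≡₁ _ _ with () ← odd S≡₁
    classify (r₁ ∷ r₂ ∷ r₃ ∷ _ ∷ []) (_ ∷ _ ∷ _ ∷ _ ∷ []) S≡₁ S≡₂ _ with trans (sym S≡₁) S≡₂
    ... | refl = ⊥-elim (occ-S≱3 u (≤-trans (s≤s (occ-chord-≥2 u (b₁ ∷ b₂ ∷ b₃ ∷ []) (r₁ ∷ r₂ ∷ r₃ ∷ []) []))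
                                            (≤-reflexive (sym (trans (cong (occ u) S≡₁) (occ-head u _))))))
    classify (r₁ ∷ r₂ ∷ r₃ ∷ r₄ ∷ r₅ ∷ R′) (_ ∷ _ ∷ _ ∷ _ ∷ _ ∷ L′) S≡₁ S≡₂ _ = ⊥-elim (
      no-long-interior u b₁ b₂ b₃ r₁ r₂ r₃ r₄ r₅ R′ S≡₁ L′ v c₁ c₂ c₃
        (∷-injectiveʳ (∷-injectiveʳ (∷-injectiveʳ (∷-injectiveʳ (∷-injectiveʳ (trans (sym S≡₁) S≡₂)))))))

module TwoCrossingChords {k} {w : Word k} (ce : Counterexample w) (z : Fin k) (P S Q : Word k)
  (w≡ : w ≡ P ++ z ∷ S ++ z ∷ Q) (nested : NoNestedChords S)
  (u a v b c : Fin k) (S≡ : S ≡ u ∷ a ∷ v ∷ b ∷ u ∷ c ∷ v ∷ []) where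
  open InCounterexample ce
  open ChordInterior ce z P S Q w≡

  private
    w≡′ : w ≡ P ++ z ∷ u ∷ a ∷ v ∷ b ∷ u ∷ c ∷ v ∷ z ∷ Q
    w≡′ = trans w≡ (cong (λ t → P ++ z ∷ t ++ z ∷ Q) S≡)

    u-chord : Chord u w
    u-chord = chord-at u (P ++ z ∷ []) (a ∷ v ∷ b ∷ []) (c ∷ v ∷ z ∷ Q) (trans w≡′ (sym (++-assoc P (z ∷ []) _)))

    v-chord : Chord v w
    v-chord = chord-at v (P ++ z ∷ u ∷ a ∷ []) (b ∷ u ∷ c ∷ []) (z ∷ Q) (trans w≡′ (sym (++-assoc P (z ∷ u ∷ a ∷ []) _)))

    u-inside≤1 : ∀ x → occ x (a ∷ v ∷ b ∷ []) ≤ 1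
    u-inside≤1 = nested u [] (a ∷ v ∷ b ∷ []) (c ∷ v ∷ []) S≡

    v-inside≤1 : ∀ x → occ x (b ∷ u ∷ c ∷ []) ≤ 1
    v-inside≤1 = nested v (u ∷ a ∷ []) (b ∷ u ∷ c ∷ []) [] S≡

    not-twice : ∀ {n} → 2 ≤ n → n ≤ 1 → ⊥
    not-twice = <⇒≱

    a≢v : a ≢ v
    a≢v refl = not-twice (occ-chord-≥2 a [] [] (b ∷ [])) (u-inside≤1 a)
    a≢b : a ≢ b
    a≢b refl = not-twice (occ-chord-≥2 a [] (v ∷ []) []) (u-inside≤1 a)
    v≢b : v ≢ b
    v≢b refl = not-twice (occ-chord-≥2 v (a ∷ []) [] []) (u-inside≤1 v)
    b≢u : b ≢ u
    b≢u refl = not-twice (occ-chord-≥2 b [] [] (c ∷ [])) (v-inside≤1 b)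
    b≢c : b ≢ c
    b≢c refl = not-twice (occ-chord-≥2 b [] (u ∷ []) []) (v-inside≤1 b)
    u≢c : u ≢ c
    u≢c refl = not-twice (occ-chord-≥2 u (b ∷ []) [] []) (v-inside≤1 u)
    a≢u : a ≢ u
    a≢u refl = <⇒≱ (occ-∈-≥1 a [] (v ∷ b ∷ [])) (≤-reflexive (Chord.occ-B u-chord))
    c≢v : c ≢ v
    c≢v refl = <⇒≱ (occ-∈-≥1 c (b ∷ u ∷ []) []) (≤-reflexive (Chord.occ-B v-chord))
    u≢v : u ≢ v
    u≢v refl = <⇒≱ (occ-∈-≥1 u (b ∷ []) (c ∷ [])) (≤-reflexive (Chord.occ-B v-chord))

    in-S : ∀ x (A B : Word k) → S ≡ A ++ x ∷ B → 1 ≤ occ x S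
    in-S x A B S≡′ = ≤-trans (occ-∈-≥1 x A B) (≤-reflexive (cong (occ x) (sym S≡′)))

    ∉S : ∀ {o} → occ o S ≡ 0 → ∀ x (A B : Word k) → S ≡ A ++ x ∷ B → o ≢ x
    ∉S o∉S x A B S≡′ refl = <⇒≱ (in-S x A B S≡′) (≤-reflexive o∉S)

    z≢u : z ≢ u
    z≢u = ∉S z∉S u [] _ S≡
    z≢a : z ≢ a
    z≢a = ∉S z∉S a (u ∷ []) _ S≡
    z≢v : z ≢ v
    z≢v = ∉S z∉S v (u ∷ a ∷ []) _ S≡
    z≢b : z ≢ b
    z≢b = ∉S z∉S b (u ∷ a ∷ v ∷ []) _ S≡
    z≢c : z ≢ c
    z≢c = ∉S z∉S c (u ∷ a ∷ v ∷ b ∷ u ∷ []) _ S≡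

    u-twice : occ u S ≡ 2
    u-twice = occ-S≡2 u
      (subst (λ t → 2 ≤ occ u t) (sym S≡) (occ-chord-≥2 u [] (a ∷ v ∷ b ∷ []) (c ∷ v ∷ [])))
    v-twice : occ v S ≡ 2
    v-twice = occ-S≡2 v
      (subst (λ t → 2 ≤ occ v t) (sym S≡) (occ-chord-≥2 v (u ∷ a ∷ []) (b ∷ u ∷ c ∷ []) []))

    occ-S-without-u-v : ∀ y → y ≢ u → y ≢ v → occ y S ≡ occ y (a ∷ b ∷ c ∷ [])
    occ-S-without-u-v y y≢u y≢v = trans (cong (occ y) S≡) (trans (occ-∷-≢ _ (≢-sym y≢u)) (same-head a
      (trans (occ-∷-≢ _ (≢-sym y≢v)) (same-head b (trans (occ-∷-≢ _ (≢-sym y≢u)) (same-head c (occ-∷-≢ [] (≢-sym y≢v))))))))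
      where
      same-head : ∀ x {L L′ : Word k} → occ y L ≡ occ y L′ → occ y (x ∷ L) ≡ occ y (x ∷ L′)
      same-head x eq with x ≟ y
      ... | yes _ = cong suc eq
      ... | no _ = eq

    z-neighbours : ∀ y → Interlaced w z y → OneOf y a b c
    z-neighbours y int = occ-triple≡1⇒one-of y a b c (trans (sym (occ-S-without-u-v y y≢u y≢v)) once)
      where
      once : occ y S ≡ 1
      once = interlaced⇒occ-inside≡1 z-chord int
      y≢u : y ≢ u
      y≢u refl with () ← trans (sym once) u-twice
      y≢v : y ≢ v
      y≢v refl with () ← trans (sym once) v-twice

    a≢c : a ≢ c
    a≢c refl = three-not-in-two b₁≢b₂ b₁≢b₃ b₂≢b₃ (a-or-b (z-neighbours _ R-b₁)) (a-or-b (z-neighbours _ R-b₂))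
                                                  (a-or-b (z-neighbours _ R-b₃))
      where
      open ExactlyThree (cubic z)
      a-or-b : ∀ {y} → OneOf y a b a → y ≡ a ⊎ y ≡ b
      a-or-b (inj₁ eq) = inj₁ eq
      a-or-b (inj₂ (inj₁ eq)) = inj₂ eq
      a-or-b (inj₂ (inj₂ eq)) = inj₁ eq

    b-once : occ b S ≡ 1
    b-once = trans (cong (occ b) S≡)
      (occ-once (u ∷ a ∷ v ∷ []) (u ∷ c ∷ v ∷ []) (b≢u ∷ ≢-sym a≢b ∷ ≢-sym v≢b ∷ [])
                                                   (b≢u ∷ b≢c ∷ ≢-sym v≢b ∷ []))

    b-neighbours : ∀ y → Interlaced w b y → OneOf y z u v
    b-neighbours = exactly-three-only (cubic b) z≢u z≢v u≢v
      (interlaced-sym w z b (inside≡1⇒interlaced z-chord b-once))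
      (interlaced-sym w u b (inside≡1⇒interlaced u-chord (occ-once (a ∷ v ∷ []) [] (≢-sym a≢b ∷ ≢-sym v≢b ∷ []) [])))
      (interlaced-sym w v b (inside≡1⇒interlaced v-chord (occ-once [] (u ∷ c ∷ []) [] (b≢u ∷ b≢c ∷ []))))

    u-neighbours : ∀ y → Interlaced w u y → OneOf y a v b
    u-neighbours y int = occ-triple≡1⇒one-of y a v b (interlaced⇒occ-inside≡1 u-chord int)

    v-neighbours : ∀ y → Interlaced w v y → OneOf y b u c
    v-neighbours y int = occ-triple≡1⇒one-of y b u c (interlaced⇒occ-inside≡1 v-chord int)

    Core : Fin k → Set
    Core x = x ≡ z ⊎ x ≡ u ⊎ x ≡ v ⊎ x ≡ b

    core-closed : ∀ x y → Core x → Interlaced w x y → Core y ⊎ y ∈ a ∷ c ∷ []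
    core-closed x y (inj₁ refl) int with z-neighbours y int
    ... | inj₁ refl = inj₂ (here refl)
    ... | inj₂ (inj₁ refl) = inj₁ (inj₂ (inj₂ (inj₂ refl)))
    ... | inj₂ (inj₂ refl) = inj₂ (there (here refl))
    core-closed x y (inj₂ (inj₁ refl)) int with u-neighbours y int
    ... | inj₁ refl = inj₂ (here refl)
    ... | inj₂ (inj₁ refl) = inj₁ (inj₂ (inj₂ (inj₁ refl)))
    ... | inj₂ (inj₂ refl) = inj₁ (inj₂ (inj₂ (inj₂ refl)))
    core-closed x y (inj₂ (inj₂ (inj₁ refl))) int with v-neighbours y int
    ... | inj₁ refl = inj₁ (inj₂ (inj₂ (inj₂ refl)))
    ... | inj₂ (inj₁ refl) = inj₁ (inj₂ (inj₁ refl))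
    ... | inj₂ (inj₂ refl) = inj₂ (there (here refl))
    core-closed x y (inj₂ (inj₂ (inj₂ refl))) int with b-neighbours y int
    ... | inj₁ refl = inj₁ (inj₁ refl)
    ... | inj₂ (inj₁ refl) = inj₁ (inj₂ (inj₁ refl))
    ... | inj₂ (inj₂ refl) = inj₁ (inj₂ (inj₂ (inj₁ refl)))

    -- Otherwise {a, c} would separate {z, u, v, b} from o.
    letters-in-S : ∀ o → o ≢ z → 1 ≤ occ o S
    letters-in-S o o≢z with occ o S in o∈S
    ... | suc _ = s≤s z≤n
    ... | zero = ⊥-elim (no-small-cut Core (a ∷ c ∷ []) (s≤s (s≤s z≤n)) core-closed z o (inj₁ refl) o∉Core z∉ac o∉ac)
      where
      o∉Core : ¬ Core o
      o∉Core (inj₁ eq) = o≢z eq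
      o∉Core (inj₂ (inj₁ eq)) = ∉S o∈S u [] _ S≡ eq
      o∉Core (inj₂ (inj₂ (inj₁ eq))) = ∉S o∈S v (u ∷ a ∷ []) _ S≡ eq
      o∉Core (inj₂ (inj₂ (inj₂ eq))) = ∉S o∈S b (u ∷ a ∷ v ∷ []) _ S≡ eq
      z∉ac : z ∉ a ∷ c ∷ []
      z∉ac (here eq) = z≢a eq
      z∉ac (there (here eq)) = z≢c eq
      o∉ac : o ∉ a ∷ c ∷ []
      o∉ac (here eq) = ∉S o∈S a (u ∷ []) _ S≡ eq
      o∉ac (there (here eq)) = ∉S o∈S c (u ∷ a ∷ v ∷ b ∷ u ∷ []) _ S≡ eq

    a-neighbours : ¬ Interlaced w a c → ∀ t → Interlaced w a t → t ≡ z ⊎ t ≡ u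
    a-neighbours ¬ac t int with t ≟ z | t ≟ u
    ... | yes eq | _ = inj₁ eq
    ... | no _ | yes eq = inj₂ eq
    ... | no t≢z | no t≢u = ⊥-elim (<⇒≱ (letters-in-S t t≢z) (≤-reflexive t∉S))
      where
      t≢a : t ≢ a
      t≢a refl = interlaced-irrefl t int
      t≢v : t ≢ v
      t≢v refl with v-neighbours a (interlaced-sym w a t int)
      ... | inj₁ eq = a≢b eq
      ... | inj₂ (inj₁ eq) = a≢u eq
      ... | inj₂ (inj₂ eq) = a≢c eq
      t≢b : t ≢ b
      t≢b refl with b-neighbours a (interlaced-sym w a t int)
      ... | inj₁ eq = z≢a (sym eq)
      ... | inj₂ (inj₁ eq) = a≢u eq
      ... | inj₂ (inj₂ eq) = a≢v eq
      t≢c : t ≢ c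
      t≢c refl = ¬ac int
      t∉S : occ t S ≡ 0
      t∉S = trans (cong (occ t) S≡) (occ-∉ _ (t≢u ∷ t≢a ∷ t≢v ∷ t≢b ∷ t≢u ∷ t≢c ∷ t≢v ∷ []))

    -- Otherwise a has its three neighbours among z and u.
    a-interlaced-c : ¬ ¬ Interlaced w a c
    a-interlaced-c ¬ac =
      three-not-in-two b₁≢b₂ b₁≢b₃ b₂≢b₃ (a-neighbours ¬ac _ R-b₁) (a-neighbours ¬ac _ R-b₂) (a-neighbours ¬ac _ R-b₃)
      where open ExactlyThree (cubic a)

    Y prefix w″ : Word k
    Y = Q ++ P
    prefix = z ∷ u ∷ a ∷ v ∷ b ∷ u ∷ c ∷ v ∷ z ∷ []
    w″ = prefix ++ Y

    rotated : Rotation w w″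
    rotated = subst (Rotation w) (cong (λ t → z ∷ t ++ z ∷ Y) S≡) (chord-to-front z P S Q w≡)

    ce″ : Counterexample w″
    ce″ = counterexample-rotation rotated ce

    module W″ = InCounterexample ce″

    once-in-Y : ∀ x → occ x prefix ≡ 1 → occ x Y ≡ 1
    once-in-Y x once = suc-injective (trans (cong (_+ occ x Y) (sym once)) (trans (sym (occ-++ x prefix Y)) (W″.double x)))

    a-in-Y : occ a Y ≡ 1
    a-in-Y = once-in-Y a (occ-once (z ∷ u ∷ []) (v ∷ b ∷ u ∷ c ∷ v ∷ z ∷ [])
      (≢-sym z≢a ∷ a≢u ∷ []) (a≢v ∷ a≢b ∷ a≢u ∷ a≢c ∷ a≢v ∷ ≢-sym z≢a ∷ []))

    b-in-Y : occ b Y ≡ 1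
    b-in-Y = once-in-Y b (occ-once (z ∷ u ∷ a ∷ v ∷ []) (u ∷ c ∷ v ∷ z ∷ [])
      (≢-sym z≢b ∷ b≢u ∷ ≢-sym a≢b ∷ ≢-sym v≢b ∷ []) (b≢u ∷ b≢c ∷ ≢-sym v≢b ∷ ≢-sym z≢b ∷ []))

    -- In z u a v b u c v z Y₁ b Y₂ the chord of b avoids a and c, so Y₁ contains c and Y₂ contains a;
    -- then the chord of a meets c twice.
    module SecondB (Y₁ Y₂ : Word k) (Y≡ : Y ≡ Y₁ ++ b ∷ Y₂) where

      b-chord : Chord b w″
      b-chord = W″.chord-at b (z ∷ u ∷ a ∷ v ∷ []) (u ∷ c ∷ v ∷ z ∷ Y₁) Y₂ (cong (prefix ++_) Y≡)

      not-b-neighbour : ∀ {x} → x ≢ z → x ≢ u → x ≢ v → occ x (u ∷ c ∷ v ∷ z ∷ Y₁) ≢ 1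
      not-b-neighbour x≢z x≢u x≢v once
        with b-neighbours _ (interlaced-rotation (rotation-sym rotated) _ _ (W″.inside≡1⇒interlaced b-chord once))
      ... | inj₁ eq = x≢z eq
      ... | inj₂ (inj₁ eq) = x≢u eq
      ... | inj₂ (inj₂ eq) = x≢v eq

      c-in-Y₁ : 1 ≤ occ c Y₁
      c-in-Y₁ with occ c Y₁ in c-in
      ... | suc _ = s≤s z≤n
      ... | zero = ⊥-elim (not-b-neighbour (≢-sym z≢c) (≢-sym u≢c) c≢v
        (trans (occ-∷-≢ _ u≢c) (trans (occ-head c _) (cong suc (trans (occ-∷-≢ _ (≢-sym c≢v)) (trans (occ-∷-≢ Y₁ z≢c) c-in))))))

      a∉Y₁ : occ a Y₁ ≡ 0
      a∉Y₁ with occ a Y₁ in a-in | ≤-trans (occ-++ˡ-≤ a Y₁ (b ∷ Y₂)) (≤-reflexive (trans (cong (occ a) (sym Y≡)) a-in-Y))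
      ... | zero | _ = refl
      ... | suc zero | _ = ⊥-elim (not-b-neighbour (≢-sym z≢a) a≢u a≢v
        (trans (occ-∷-≢ _ (≢-sym a≢u)) (trans (occ-∷-≢ _ (≢-sym a≢c))
          (trans (occ-∷-≢ _ (≢-sym a≢v)) (trans (occ-∷-≢ Y₁ z≢a) a-in)))))
      ... | suc (suc _) | s≤s ()

      a-in-Y₂ : occ a Y₂ ≡ 1
      a-in-Y₂ = trans (sym (occ-∷-≢ Y₂ (≢-sym a≢b)))
        (trans (cong (_+ occ a (b ∷ Y₂)) (sym a∉Y₁)) (trans (sym (occ-++ a Y₁ (b ∷ Y₂))) (trans (cong (occ a) (sym Y≡)) a-in-Y)))

      a-not-interlaced-c : ¬ Interlaced w a c
      a-not-interlaced-c ac with split-at-first a 0 Y₂ a-in-Y₂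
      ... | Y₂₁ , Y₂₂ , Y₂≡ , _ , _ = <⇒≱ c-twice (≤-reflexive c-once)
        where
        rest : Word k
        rest = v ∷ z ∷ Y₁ ++ b ∷ Y₂₁
        a-chord : Chord a w″
        a-chord = W″.chord-at a (z ∷ u ∷ []) (v ∷ b ∷ u ∷ c ∷ rest) Y₂₂
          (cong (prefix ++_) (trans Y≡ (trans (cong (λ t → Y₁ ++ b ∷ t) Y₂≡) (sym (++-assoc Y₁ (b ∷ Y₂₁) (a ∷ Y₂₂))))))
        c-once : occ c (v ∷ b ∷ u ∷ c ∷ rest) ≡ 1
        c-once = interlaced⇒occ-inside≡1 a-chord (interlaced-rotation rotated a c ac)
        c-twice : 2 ≤ occ c (v ∷ b ∷ u ∷ c ∷ rest)
        c-twice = begin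
          2                             ≤⟨ s≤s c-in-Y₁ ⟩
          suc (occ c Y₁)                ≤⟨ s≤s (occ-++ˡ-≤ c Y₁ (b ∷ Y₂₁)) ⟩
          suc (occ c (Y₁ ++ b ∷ Y₂₁))   ≡⟨ cong suc (sym (trans (occ-∷-≢ _ (≢-sym c≢v)) (occ-∷-≢ _ z≢c))) ⟩
          suc (occ c rest)              ≡⟨ sym (trans (occ-∷-≢ _ (≢-sym c≢v))
                                                (trans (occ-∷-≢ _ b≢c) (trans (occ-∷-≢ _ u≢c) (occ-head c rest)))) ⟩
          occ c (v ∷ b ∷ u ∷ c ∷ rest)  ∎
          where open ≤-Reasoning

  two-crossing-chords-impossible : ⊥
  two-crossing-chords-impossible with split-at-first b 0 Y b-in-Y
  ... | Y₁ , Y₂ , Y≡ , _ , _ = a-interlaced-c (SecondB.a-not-interlaced-c Y₁ Y₂ Y≡)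

-- Twin chords

record TwinChords {k} (w : Word k) : Set where
  constructor twin-chords
  field
    z u α β γ : Fin k
    P Q : Word k
    w≡ : w ≡ P ++ z ∷ (u ∷ α ∷ β ∷ γ ∷ u ∷ []) ++ z ∷ Q
    inside-distinct : ∀ x → occ x (α ∷ β ∷ γ ∷ []) ≤ 1

-- Twin chords found inside the chord z S z: either z itself with S = u α β γ u, or nested in S.
data TwinChordsIn {k} (w : Word k) (z : Fin k) (S : Word k) : Set where
  whole : ∀ u α β γ P Q → w ≡ P ++ z ∷ (u ∷ α ∷ β ∷ γ ∷ u ∷ []) ++ z ∷ Q → S ≡ u ∷ α ∷ β ∷ γ ∷ u ∷ [] →
    (∀ x → occ x (α ∷ β ∷ γ ∷ []) ≤ 1) → TwinChordsIn w z S
  nested : (tc : TwinChords w) → occ (TwinChords.z tc) S ≡ 2 → occ (TwinChords.u tc) S ≡ 2 → TwinChordsIn w z S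

twin-chords-of : ∀ {k} {w : Word k} {z S} → TwinChordsIn w z S → TwinChords w
twin-chords-of (whole u α β γ P Q w≡ _ distinct) = twin-chords _ u α β γ P Q w≡ distinct
twin-chords-of (nested tc _ _) = tc

module _ {k} {w : Word k} (ce : Counterexample w) where
  open InCounterexample ce

  twin-chords-within : ∀ n z (P S Q : Word k) → length S ≤ n → w ≡ P ++ z ∷ S ++ z ∷ Q →
    ∀ a → occ a S ≡ 2 → ¬ ¬ TwinChordsIn w z S
  twin-chords-within zero z P [] Q _ _ a ()
  twin-chords-within (suc n) z P S Q ∣S∣≤ w≡ a a-twice no-twins =
    from-shape (InnermostInterior.innermost-shape ce z P S Q w≡ no-nested a a-twice)
    where
    open ChordInterior ce z P S Q w≡
    -- A letter twice inside a chord y B y nested in S already yields twin chords within y B y.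
    not-full : ∀ y S₁ B S₂ → S ≡ S₁ ++ y ∷ B ++ y ∷ S₂ → ∀ c → occ c B ≢ 2
    not-full y S₁ B S₂ S≡ c c-twice =
      twin-chords-within n y (P ++ z ∷ S₁) B (S₂ ++ z ∷ Q) ∣B∣≤n (chord-in-S y S₁ B S₂ S≡) c c-twice (no-twins ∘ widen)
      where
      ∣B∣≤n : length B ≤ n
      ∣B∣≤n = ≤-pred (≤-trans (≤-trans (s≤s (length-infix-≤ [] B (y ∷ S₂)))
                                        (≤-trans (m≤n+m _ (length S₁)) (≤-reflexive (sym (length-++ S₁)))))
                              (≤-trans (≤-reflexive (cong length (sym S≡))) ∣S∣≤))
      in-S : ∀ x → 2 ≤ occ x B → occ x S ≡ 2
      in-S x 2≤ = occ-S≡2 x (≤-trans 2≤ (≤-trans (occ-inside-≤ x y S₁ B S₂) (≤-reflexive (cong (occ x) (sym S≡)))))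
      y-twice : occ y S ≡ 2
      y-twice = occ-S≡2 y (≤-trans (occ-chord-≥2 y S₁ B S₂) (≤-reflexive (cong (occ y) (sym S≡))))
      widen : TwinChordsIn w y B → TwinChordsIn w z S
      widen (whole u α β γ P′ Q′ w≡′ B≡ distinct) =
        nested (twin-chords y u α β γ P′ Q′ w≡′ distinct) y-twice
          (in-S u (subst (λ t → 2 ≤ occ u t) (sym B≡) (occ-chord-≥2 u [] (α ∷ β ∷ γ ∷ []) [])))
      widen (nested tc z′-twice u-twice) =
        nested tc (in-S _ (≤-reflexive (sym z′-twice))) (in-S _ (≤-reflexive (sym u-twice)))
    no-nested : NoNestedChords S
    no-nested y S₁ B S₂ S≡ c = ≤-pred (≤∧≢⇒<
      (≤-trans (occ-inside-≤ c y S₁ B S₂) (≤-trans (≤-reflexive (cong (occ c) (sym S≡))) (occ-S≤2 c)))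
      (not-full y S₁ B S₂ S≡ c))
    from-shape : InnermostShape S → ⊥
    from-shape (one-chord u α β γ S≡) =
      no-twins (whole u α β γ P Q (trans w≡ (cong (λ t → P ++ z ∷ t ++ z ∷ Q) S≡)) S≡
                      (no-nested u [] (α ∷ β ∷ γ ∷ []) [] S≡))
    from-shape (two-chords u a′ v b c S≡) =
      TwoCrossingChords.two-crossing-chords-impossible ce z P S Q w≡ no-nested u a′ v b c S≡

module _ {k} {w : Word k} (ce : Counterexample w) where
  open InCounterexample ce

  -- The chords of x and y are parallel and cross the same chords.
  twins-from-pattern : ∀ x y (P B Q : Word k) → w ≡ P ++ x ∷ y ∷ B ++ y ∷ x ∷ Q → x ≢ y →
    TwinsOf (Interlaced w) x y
  twins-from-pattern x y P B Q w≡ x≢y = x≢y , λ c c≢x c≢y →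
    (λ int → inside≡1⇒interlaced y-chord (trans (sym (occ-y-inside c c≢y)) (interlaced⇒occ-inside≡1 x-chord int))) ,
    (λ int → inside≡1⇒interlaced x-chord (trans (occ-y-inside c c≢y) (interlaced⇒occ-inside≡1 y-chord int)))
    where
    x-chord : Chord x w
    x-chord = chord-at x P (y ∷ B ++ y ∷ []) Q (trans w≡ (cong (λ t → P ++ x ∷ y ∷ t) (sym (++-assoc B (y ∷ []) (x ∷ Q)))))
    y-chord : Chord y w
    y-chord = chord-at y (P ++ x ∷ []) B (x ∷ Q) (trans w≡ (sym (++-assoc P (x ∷ []) _)))
    occ-y-inside : ∀ c → c ≢ y → occ c (y ∷ B ++ y ∷ []) ≡ occ c B
    occ-y-inside c c≢y = trans (occ-∷-≢ _ (≢-sym c≢y)) (occ-∷ʳ-≢ B (≢-sym c≢y))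

  twin-chords-twins : (tc : TwinChords w) → TwinsOf (Interlaced w) (TwinChords.z tc) (TwinChords.u tc)
  twin-chords-twins (twin-chords z u α β γ P Q w≡ _) = twins-from-pattern z u P (α ∷ β ∷ γ ∷ []) Q w≡ z≢u
    where
    z≢u : z ≢ u
    z≢u refl = 0≢1+n (trans (sym (Chord.occ-B (chord-at z P (u ∷ α ∷ β ∷ γ ∷ u ∷ []) Q w≡))) (occ-head z _))

  all-neighbours : ∀ x {p q r} → (∀ y → y ≢ x → OneOf y p q r) → ∀ y → OneOf y p q r → Interlaced w x y
  all-neighbours x only-pqr y y∈ with cubic x
  ... | exactly-three c₁ c₂ c₃ c₁≢c₂ c₁≢c₃ c₂≢c₃ r₁ r₂ r₃ _
    with one-of-exhaust-all (only-pqr c₁ (≢-sym (not-self r₁))) (only-pqr c₂ (≢-sym (not-self r₂)))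
                            (only-pqr c₃ (≢-sym (not-self r₃))) c₁≢c₂ c₁≢c₃ c₂≢c₃ y y∈
    where
    not-self : ∀ {t} → Interlaced w x t → x ≢ t
    not-self int refl = interlaced-irrefl x int
  ... | inj₁ refl = r₁
  ... | inj₂ (inj₁ refl) = r₂
  ... | inj₂ (inj₂ refl) = r₃

-- z and u are twins; the rest of the word, read from the other side of z, must contain a second,
-- disjoint pair of twins.
module NoTwinChords {k} {w : Word k} (ce : Counterexample w) (tc : TwinChords w) where
  open TwinChords tc

  private
    B₀ S₀ Y w₂ : Word k
    B₀ = α ∷ β ∷ γ ∷ []
    S₀ = u ∷ α ∷ β ∷ γ ∷ u ∷ []
    Y = Q ++ P
    w₂ = z ∷ Y ++ z ∷ S₀

    rotated : Rotation w w₂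
    rotated = chord-to-back z P S₀ Q w≡

    ce₂ : Counterexample w₂
    ce₂ = counterexample-rotation rotated ce

    open InCounterexample ce₂

    z-chord : Chord z w₂
    z-chord = chord-at z [] Y S₀ refl

    u-chord : Chord u w₂
    u-chord = chord-at u (z ∷ Y ++ z ∷ []) B₀ [] (cong (z ∷_) (sym (++-assoc Y (z ∷ []) _)))

    z∉Y : occ z Y ≡ 0
    z∉Y = Chord.occ-B z-chord

    u∉Y : occ u Y ≡ 0
    u∉Y = n≤0⇒n≡0 (≤-trans (≤-trans (occ-++ˡ-≤ u Y (z ∷ [])) (occ-∷-≤ u z _)) (≤-reflexive (Chord.occ-P u-chord)))

    twice-in-Y≢ : ∀ {x t} → occ x Y ≡ 0 → occ t Y ≡ 2 → x ≢ t
    twice-in-Y≢ x∉Y t-twice refl = 0≢1+n (trans (sym x∉Y) t-twice)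

    not-twice-in-B₀ : ∀ {n} → 2 ≤ n → n ≤ 1 → ⊥
    not-twice-in-B₀ = <⇒≱

    α≢β : α ≢ β
    α≢β refl = not-twice-in-B₀ (occ-chord-≥2 α [] [] (γ ∷ [])) (inside-distinct α)
    α≢γ : α ≢ γ
    α≢γ refl = not-twice-in-B₀ (occ-chord-≥2 α [] (β ∷ []) []) (inside-distinct α)
    β≢γ : β ≢ γ
    β≢γ refl = not-twice-in-B₀ (occ-chord-≥2 β (α ∷ []) [] []) (inside-distinct β)

    ≢-u : ∀ x (A C : Word k) → B₀ ≡ A ++ x ∷ C → x ≢ u
    ≢-u x A C B₀≡ refl =
      <⇒≱ (≤-trans (occ-∈-≥1 x A C) (≤-reflexive (cong (occ x) (sym B₀≡)))) (≤-reflexive (Chord.occ-B u-chord))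
    ≢-z : ∀ x (A C : Word k) → S₀ ≡ A ++ x ∷ C → x ≢ z
    ≢-z x A C S₀≡ refl =
      <⇒≱ (≤-trans (occ-∈-≥1 x A C) (≤-reflexive (cong (occ x) (sym S₀≡)))) (≤-reflexive (Chord.occ-Q z-chord))

    α≢u : α ≢ u
    α≢u = ≢-u α [] _ refl
    β≢u : β ≢ u
    β≢u = ≢-u β (α ∷ []) _ refl
    γ≢u : γ ≢ u
    γ≢u = ≢-u γ (α ∷ β ∷ []) _ refl
    u≢z : u ≢ z
    u≢z = ≢-z u [] _ refl
    α≢z : α ≢ z
    α≢z = ≢-z α (u ∷ []) _ refl
    β≢z : β ≢ z
    β≢z = ≢-z β (u ∷ α ∷ []) _ refl
    γ≢z : γ ≢ z
    γ≢z = ≢-z γ (u ∷ α ∷ β ∷ []) _ refl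

    occ-w₂ : ∀ x → x ≢ z → x ≢ u → occ x w₂ ≡ occ x Y + occ x B₀
    occ-w₂ x x≢z x≢u = begin
      occ x w₂                              ≡⟨ occ-∷-≢ _ (≢-sym x≢z) ⟩
      occ x (Y ++ z ∷ S₀)                   ≡⟨ occ-++ x Y _ ⟩
      occ x Y + occ x (z ∷ S₀)
        ≡⟨ cong (occ x Y +_) (trans (occ-∷-≢ S₀ (≢-sym x≢z)) (occ-∷-≢ _ (≢-sym x≢u))) ⟩
      occ x Y + occ x (B₀ ++ u ∷ [])        ≡⟨ cong (occ x Y +_) (occ-∷ʳ-≢ B₀ (≢-sym x≢u)) ⟩
      occ x Y + occ x B₀                    ∎
      where open ≡-Reasoning

    once-in-B₀ : ∀ {x} → OneOf x α β γ → occ x B₀ ≡ 1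
    once-in-B₀ = occ-triple≡1 α≢β α≢γ β≢γ

    ∈B₀⇒≢z : ∀ {x} → OneOf x α β γ → x ≢ z
    ∈B₀⇒≢z (inj₁ refl) = α≢z
    ∈B₀⇒≢z (inj₂ (inj₁ refl)) = β≢z
    ∈B₀⇒≢z (inj₂ (inj₂ refl)) = γ≢z

    ∈B₀⇒≢u : ∀ {x} → OneOf x α β γ → x ≢ u
    ∈B₀⇒≢u (inj₁ refl) = α≢u
    ∈B₀⇒≢u (inj₂ (inj₁ refl)) = β≢u
    ∈B₀⇒≢u (inj₂ (inj₂ refl)) = γ≢u

    once-in-Y : ∀ {x} → OneOf x α β γ → occ x Y ≡ 1
    once-in-Y {x} x∈ = +-cancelʳ-≡ 1 _ _
      (trans (cong (occ x Y +_) (sym (once-in-B₀ x∈))) (trans (sym (occ-w₂ x (∈B₀⇒≢z x∈) (∈B₀⇒≢u x∈))) (double x)))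

    z-neighbour : ∀ {x} → OneOf x α β γ → Interlaced w₂ x z
    z-neighbour x∈ = interlaced-sym w₂ z _ (inside≡1⇒interlaced z-chord (once-in-Y x∈))

    u-neighbour : ∀ {x} → OneOf x α β γ → Interlaced w₂ x u
    u-neighbour x∈ = interlaced-sym w₂ u _ (inside≡1⇒interlaced u-chord (once-in-B₀ x∈))

    z-u-twins : TwinsOf (Interlaced w₂) z u
    z-u-twins = twins-transport (interlaced-rotation rotated) (interlaced-rotation (rotation-sym rotated)) (twin-chords-twins ce tc)

    -- If a chord u′ x₁ x₂ x₃ u′ fills Y, then β and γ both have neighbours z, u, u′.
    twins-in-Y : TwinChordsIn w₂ z Y → ⊥
    twins-in-Y (whole u′ x₁ x₂ x₃ P′ Q′ w≡′ Y≡ _) =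
      no-twins (z , u , β , γ , z-u-twins , β-γ-twins , ≢-sym β≢z , ≢-sym γ≢z , ≢-sym β≢u , ≢-sym γ≢u)
      where
      u′-twice : occ u′ Y ≡ 2
      u′-twice = ≤-antisym (occ-infix≤2 (z ∷ []) Y (z ∷ S₀) refl u′)
        (subst (λ t → 2 ≤ occ u′ t) (sym Y≡) (occ-chord-≥2 u′ [] (x₁ ∷ x₂ ∷ x₃ ∷ []) []))
      u′-chord : Chord u′ w₂
      u′-chord = chord-at u′ (z ∷ []) (x₁ ∷ x₂ ∷ x₃ ∷ []) (z ∷ S₀) (cong (λ t → z ∷ t ++ z ∷ S₀) Y≡)
      u′-neighbour : ∀ {x} → OneOf x α β γ → Interlaced w₂ x u′
      u′-neighbour {x} x∈ = interlaced-sym w₂ u′ x (inside≡1⇒interlaced u′-chord (trans (sym occ-Y≡) (once-in-Y x∈)))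
        where
        x≢u′ : x ≢ u′
        x≢u′ refl = 0≢1+n (suc-injective (trans (sym (once-in-Y x∈)) u′-twice))
        occ-Y≡ : occ x Y ≡ occ x (x₁ ∷ x₂ ∷ x₃ ∷ [])
        occ-Y≡ = trans (cong (occ x) Y≡)
          (trans (occ-∷-≢ _ (≢-sym x≢u′)) (occ-∷ʳ-≢ (x₁ ∷ x₂ ∷ x₃ ∷ []) (≢-sym x≢u′)))
      z≢u′ : z ≢ u′
      z≢u′ = twice-in-Y≢ z∉Y u′-twice
      u≢u′ : u ≢ u′
      u≢u′ = twice-in-Y≢ u∉Y u′-twice
      neighbours : ∀ {x} → OneOf x α β γ → ∀ c → Interlaced w₂ x c → OneOf c z u u′
      neighbours x∈ = exactly-three-only (cubic _) (≢-sym u≢z) z≢u′ u≢u′ (z-neighbour x∈) (u-neighbour x∈) (u′-neighbour x∈)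
      neighbour : ∀ {x} → OneOf x α β γ → ∀ c → OneOf c z u u′ → Interlaced w₂ x c
      neighbour x∈ c (inj₁ refl) = z-neighbour x∈
      neighbour x∈ c (inj₂ (inj₁ refl)) = u-neighbour x∈
      neighbour x∈ c (inj₂ (inj₂ refl)) = u′-neighbour x∈
      β∈ : OneOf β α β γ
      β∈ = inj₂ (inj₁ refl)
      γ∈ : OneOf γ α β γ
      γ∈ = inj₂ (inj₂ refl)
      β-γ-twins : TwinsOf (Interlaced w₂) β γ
      β-γ-twins = β≢γ , λ c _ _ →
        (λ int → neighbour γ∈ c (neighbours β∈ c int)) , (λ int → neighbour β∈ c (neighbours γ∈ c int))
    twins-in-Y (nested tc′ z′-twice u′-twice) =
      no-twins (z , u , TwinChords.z tc′ , TwinChords.u tc′ , z-u-twins , twin-chords-twins ce₂ tc′ ,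
                twice-in-Y≢ z∉Y z′-twice , twice-in-Y≢ z∉Y u′-twice , twice-in-Y≢ u∉Y z′-twice , twice-in-Y≢ u∉Y u′-twice)

    twice-in-Y-impossible : ∀ a → occ a Y ≢ 2
    twice-in-Y-impossible a a-twice = twin-chords-within ce₂ (length Y) z [] Y S₀ ≤-refl refl a a-twice twins-in-Y

    α∈ : OneOf α α β γ
    α∈ = inj₁ refl
    β∈ : OneOf β α β γ
    β∈ = inj₂ (inj₁ refl)
    γ∈ : OneOf γ α β γ
    γ∈ = inj₂ (inj₂ refl)

    z≢u : z ≢ u
    z≢u = ≢-sym u≢z

    every : (∀ a → occ a Y ≢ 2) → ∀ s → s ≢ z → s ≢ u → OneOf s α β γ
    every no-twice s s≢z s≢u = occ-triple≡1⇒one-of s α β γ (≤-antisym (inside-distinct s) 1≤occ-B₀)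
      where
      occ-Y≤1 : occ s Y ≤ 1
      occ-Y≤1 = ≤-pred (≤∧≢⇒< (occ-infix≤2 (z ∷ []) Y (z ∷ S₀) refl s) (no-twice s))
      1≤occ-B₀ : 1 ≤ occ s B₀
      1≤occ-B₀ = +-cancelˡ-≤ 1 _ _ (≤-trans (≤-reflexive (trans (sym (double s)) (occ-w₂ s s≢z s≢u))) (+-monoˡ-≤ _ occ-Y≤1))

    -- If x and y are interlaced, the remaining letter t has no third neighbour left.
    not-z-u-or : ∀ {t r} → t ≢ z → t ≢ u → t ≢ r → ¬ OneOf t z u r
    not-z-u-or t≢z _ _ (inj₁ eq) = t≢z eq
    not-z-u-or _ t≢u _ (inj₂ (inj₁ eq)) = t≢u eq
    not-z-u-or _ _ t≢r (inj₂ (inj₂ eq)) = t≢r eq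

    matched : ∀ {x y t} → OneOf x α β γ → OneOf y α β γ → x ≢ y → x ≢ t → y ≢ t → t ≢ z → t ≢ u →
      (∀ s → s ≢ z → s ≢ u → OneOf s x y t) → Interlaced w₂ x y → ⊥
    matched {x} {y} {t} x∈ y∈ x≢y x≢t y≢t t≢z t≢u every′ x-y with exactly-three-avoiding (cubic t) z u
    ... | s , t-s , s≢z , s≢u with every′ s s≢z s≢u
    ...   | inj₁ refl = not-z-u-or t≢z t≢u (≢-sym y≢t)
      (exactly-three-only (cubic x) z≢u (≢-sym (∈B₀⇒≢z y∈)) (≢-sym (∈B₀⇒≢u y∈))
                          (z-neighbour x∈) (u-neighbour x∈) x-y t (interlaced-sym w₂ t x t-s))
    ...   | inj₂ (inj₁ refl) = not-z-u-or t≢z t≢u (≢-sym x≢t)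
      (exactly-three-only (cubic y) z≢u (≢-sym (∈B₀⇒≢z x∈)) (≢-sym (∈B₀⇒≢u x∈))
                          (z-neighbour y∈) (u-neighbour y∈) (interlaced-sym w₂ x y x-y) t (interlaced-sym w₂ t y t-s))
    ...   | inj₂ (inj₂ refl) = interlaced-irrefl t t-s

    -- Otherwise only z, u, α, β, γ remain, and α, β, γ would need a perfect matching among themselves.
    all-once-in-Y-impossible : (∀ a → occ a Y ≢ 2) → ⊥
    all-once-in-Y-impossible no-twice with exactly-three-avoiding (cubic α) z u
    ... | t , α-t , t≢z , t≢u with every no-twice t t≢z t≢u
    ...   | inj₁ refl = interlaced-irrefl t α-t
    ...   | inj₂ (inj₁ refl) = matched α∈ β∈ α≢β α≢γ β≢γ γ≢z γ≢u (every no-twice) α-t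
    ...   | inj₂ (inj₂ refl) =
      matched α∈ γ∈ α≢γ α≢β (≢-sym β≢γ) β≢z β≢u (λ s s≢z s≢u → one-of-swap (every no-twice s s≢z s≢u)) α-t

  no-twin-chords : ⊥
  no-twin-chords = all-once-in-Y-impossible twice-in-Y-impossible

module _ {k} {w : Word k} (ce : Counterexample w) (z : Fin k) (P S Q : Word k) (w≡ : w ≡ P ++ z ∷ S ++ z ∷ Q) where

  private
    Y w₁ : Word k
    Y = Q ++ P
    w₁ = z ∷ S ++ z ∷ Y

    ce₁ : Counterexample w₁
    ce₁ = counterexample-rotation (chord-to-front z P S Q w≡) ce

    ce₁′ : Counterexample (z ∷ Y ++ z ∷ S)
    ce₁′ = counterexample-rotation (rotation (z ∷ S) (z ∷ Y) refl refl) ce₁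

    open InCounterexample ce₁

    twice-in-S-impossible : ∀ a → occ a S ≢ 2
    twice-in-S-impossible a a-twice =
      twin-chords-within ce₁ (length S) z [] S Y ≤-refl refl a a-twice (NoTwinChords.no-twin-chords ce₁ ∘ twin-chords-of)

    twice-in-Y-impossible : ∀ a → occ a Y ≢ 2
    twice-in-Y-impossible a a-twice =
      twin-chords-within ce₁′ (length Y) z [] Y S ≤-refl refl a a-twice (NoTwinChords.no-twin-chords ce₁′ ∘ twin-chords-of)

    once-in-S : ∀ x → x ≢ z → occ x S ≡ 1
    once-in-S x x≢z = ≤-antisym (at-most-once S (z ∷ []) (z ∷ Y) refl (twice-in-S-impossible x))
      (+-cancelʳ-≤ (occ x Y) 1 (occ x S)
        (≤-trans (+-monoʳ-≤ 1 (at-most-once Y (z ∷ S ++ z ∷ []) [] w₁≡ (twice-in-Y-impossible x))) (≤-reflexive (sym sum≡2))))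
      where
      at-most-once : ∀ (I A C : Word k) → w₁ ≡ A ++ I ++ C → occ x I ≢ 2 → occ x I ≤ 1
      at-most-once I A C w₁≡′ ≢2 = ≤-pred (≤∧≢⇒< (occ-infix≤2 A I C w₁≡′ x) ≢2)
      w₁≡ : w₁ ≡ (z ∷ S ++ z ∷ []) ++ Y ++ []
      w₁≡ = cong (z ∷_) (trans (cong (λ t → S ++ z ∷ t) (sym (++-identityʳ Y))) (sym (++-assoc S (z ∷ []) (Y ++ []))))
      sum≡2 : occ x S + occ x Y ≡ 2
      sum≡2 = trans (cong (occ x S +_) (sym (occ-∷-≢ Y (≢-sym x≢z))))
        (trans (sym (occ-++ x S (z ∷ Y))) (trans (sym (occ-∷-≢ _ (≢-sym x≢z))) (double x)))

  -- Every other letter occurs once on each side of z, hence crosses z: the graph is K₄, whose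
  -- vertices form two pairs of twins.
  chord-contradiction : ⊥
  chord-contradiction = no-twins (z , b₁ , b₂ , b₃ , z-b₁-twins , b₂-b₃-twins , z≢ R-b₂ , z≢ R-b₃ , b₁≢b₂ , b₁≢b₃)
    where
    open ExactlyThree (cubic z)
    z≢ : ∀ {x} → Interlaced w₁ z x → z ≢ x
    z≢ int refl = interlaced-irrefl z int
    crosses-z : ∀ x → x ≢ z → Interlaced w₁ z x
    crosses-z x x≢z = inside≡1⇒interlaced (chord-at z [] S Y refl) (once-in-S x x≢z)
    letters : ∀ y → y ≡ z ⊎ OneOf y b₁ b₂ b₃
    letters y with y ≟ z
    ... | yes eq = inj₁ eq
    ... | no y≢z = inj₂ (only y (crosses-z y y≢z))
    drop-first : ∀ {y p q r} → y ≡ z ⊎ OneOf y p q r → y ≢ p → OneOf y z q r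
    drop-first (inj₁ eq) _ = inj₁ eq
    drop-first (inj₂ (inj₁ eq)) y≢p = ⊥-elim (y≢p eq)
    drop-first (inj₂ (inj₂ y∈)) _ = inj₂ y∈
    but-b₁ : ∀ y → y ≢ b₁ → OneOf y z b₂ b₃
    but-b₁ y = drop-first (letters y)
    but-b₂ : ∀ y → y ≢ b₂ → OneOf y z b₁ b₃
    but-b₂ y = drop-first (map₂ (one-of-swap ∘ one-of-rotate) (letters y))
    but-b₃ : ∀ y → y ≢ b₃ → OneOf y z b₁ b₂
    but-b₃ y = drop-first (map₂ (one-of-rotate ∘ one-of-rotate) (letters y))
    z-b₁-twins : TwinsOf (Interlaced w₁) z b₁
    z-b₁-twins = z≢ R-b₁ , λ c c≢z c≢b₁ →
      (λ _ → all-neighbours ce₁ b₁ but-b₁ c (but-b₁ c c≢b₁)) , (λ _ → crosses-z c c≢z)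
    b₂-b₃-twins : TwinsOf (Interlaced w₁) b₂ b₃
    b₂-b₃-twins = b₂≢b₃ , λ c c≢b₂ c≢b₃ →
      (λ _ → all-neighbours ce₁ b₃ but-b₃ c (but-b₃ c c≢b₃)) , (λ _ → all-neighbours ce₁ b₂ but-b₂ c (but-b₂ c c≢b₂))

no-counterexample : ∀ {k} {w : Word k} → Counterexample w → Fin k → ⊥
no-counterexample ce z with InCounterexample.chord-of-letter ce z
... | chord P S Q w≡ _ _ _ = chord-contradiction ce z P S Q w≡

-- Circle graphs

T-ext : ∀ {a b : Bool} → (T a → T b) → (T b → T a) → a ≡ b
T-ext {false} {false} _ _ = refl
T-ext {false} {true} _ b⇒a = ⊥-elim (b⇒a _)
T-ext {true} {false} a⇒b _ = ⊥-elim (a⇒b _)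
T-ext {true} {true} _ _ = refl

module CircleRepresentation {n k} (G : Graph n) (w : Word k) (f : Fin n ⤖ Fin k)
  (adj⇔ : ∀ u v → T (Adj G u v) ⇔ Interlaced w (Bijection.to f u) (Bijection.to f v)) where

  open Bijection f using (to; injective; strictlySurjective)

  from : Fin k → Fin n
  from a = proj₁ (strictlySurjective a)

  to-from : ∀ a → to (from a) ≡ a
  to-from a = proj₂ (strictlySurjective a)

  from-to : ∀ u → from (to u) ≡ u
  from-to u = injective (to-from (to u))

  from-≢ : ∀ {a b} → a ≢ b → from a ≢ from b
  from-≢ a≢b eq = a≢b (trans (sym (to-from _)) (trans (cong to eq) (to-from _)))

  adj⇒interlaced : ∀ u v → T (Adj G u v) → Interlaced w (to u) (to v)
  adj⇒interlaced u v = Equivalence.to (adj⇔ u v)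

  interlaced⇒adj : ∀ a b → Interlaced w a b → T (Adj G (from a) (from b))
  interlaced⇒adj a b int =
    Equivalence.from (adj⇔ (from a) (from b)) (subst₂ (Interlaced w) (sym (to-from a)) (sym (to-from b)) int)

  neighbours : Fin n → List (Fin n)
  neighbours v = filter (λ u → T? (Adj G v u)) (allFin n)

  cubic-word : Cubic G → ∀ a → ExactlyThree (Interlaced w a)
  cubic-word cubic a = three (neighbours (from a)) refl
    where
    v : Fin n
    v = from a
    three : ∀ L → neighbours v ≡ L → ExactlyThree (Interlaced w a)
    three (u₁ ∷ u₂ ∷ u₃ ∷ []) N≡L =
      exactly-three (to u₁) (to u₂) (to u₃) (u₁≢u₂ ∘ injective) (u₁≢u₃ ∘ injective) (u₂≢u₃ ∘ injective)
        (interlaced (here refl)) (interlaced (there (here refl))) (interlaced (there (there (here refl)))) only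
      where
      unique : Unique (u₁ ∷ u₂ ∷ u₃ ∷ [])
      unique = subst Unique N≡L (filter⁺ (λ u → T? (Adj G v u)) (allFin⁺ n))
      u₁≢u₂ : u₁ ≢ u₂
      u₁≢u₂ with (u₁≢u₂ ∷ _) ∷ _ ← unique = u₁≢u₂
      u₁≢u₃ : u₁ ≢ u₃
      u₁≢u₃ with (_ ∷ u₁≢u₃ ∷ []) ∷ _ ← unique = u₁≢u₃
      u₂≢u₃ : u₂ ≢ u₃
      u₂≢u₃ with _ ∷ (u₂≢u₃ ∷ []) ∷ _ ← unique = u₂≢u₃
      interlaced : ∀ {u} → u ∈ u₁ ∷ u₂ ∷ u₃ ∷ [] → Interlaced w a (to u)
      interlaced {u} u∈ = subst (λ t → Interlaced w t (to u)) (to-from a)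
        (adj⇒interlaced v u (proj₂ (∈-filter⁻ (λ u → T? (Adj G v u)) {xs = allFin n} (subst (u ∈_) (sym N≡L) u∈))))
      only : ∀ c → Interlaced w a c → OneOf c (to u₁) (to u₂) (to u₃)
      only c int with subst (from c ∈_) N≡L (∈-filter⁺ (λ u → T? (Adj G v u)) (∈-allFin (from c)) (interlaced⇒adj a c int))
      ... | here eq = inj₁ (trans (sym (to-from c)) (cong to eq))
      ... | there (here eq) = inj₂ (inj₁ (trans (sym (to-from c)) (cong to eq)))
      ... | there (there (here eq)) = inj₂ (inj₂ (trans (sym (to-from c)) (cong to eq)))
    three [] N≡L = ⊥-elim (0≢1+n (trans (sym (cong length N≡L)) (cubic v)))
    three (_ ∷ []) N≡L = ⊥-elim (0≢1+n (suc-injective (trans (sym (cong length N≡L)) (cubic v))))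
    three (_ ∷ _ ∷ []) N≡L = ⊥-elim (0≢1+n (suc-injective (suc-injective (trans (sym (cong length N≡L)) (cubic v)))))
    three (_ ∷ _ ∷ _ ∷ _ ∷ _) N≡L =
      ⊥-elim (1+n≢0 (suc-injective (suc-injective (suc-injective (trans (sym (cong length N≡L)) (cubic v))))))

  no-small-cut-word : KConnected 3 G → NoSmallCut (Interlaced w)
  no-small-cut-word (_ , connected) C X ∣X∣≤2 closed a b C-a ¬C-b a∉X b∉X = ¬C-b (subst C (to-from b) (reach→C path))
    where
    X′ : List (Fin n)
    X′ = map from X
    from-∉ : ∀ c → c ∉ X → from c ∉ X′
    from-∉ c c∉X c∈ with ∈-map⁻ from c∈
    ... | x , x∈X , eq = c∉X (subst (_∈ X) (sym (trans (sym (to-from c)) (trans (cong to eq) (to-from x)))) x∈X)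
    path : Reach G X′ (from a) (from b)
    path = connected X′ (s≤s (subst (_≤ 2) (sym (length-map from X)) ∣X∣≤2)) (from a) (from b) (from-∉ a a∉X) (from-∉ b b∉X)
    reach→C : ∀ {t} → Reach G X′ (from a) t → C (to t)
    reach→C (here _) = subst C (sym (to-from a)) C-a
    reach→C (step {v} {t} r adj t∉X′) with closed (to v) (to t) (reach→C r) (adj⇒interlaced v t adj)
    ... | inj₁ C-t = C-t
    ... | inj₂ t∈X = ⊥-elim (t∉X′ (subst (_∈ X′) (from-to t) (∈-map⁺ from t∈X)))

  twins-word : ∀ {a b} → TwinsOf (Interlaced w) a b → Twins G (from a) (from b)
  twins-word {a} {b} (a≢b , same) = from-≢ a≢b , λ u u≢a u≢b →
    T-ext (λ adj → adj-to b u (proj₁ (same (to u) (letter-≢ u u≢a) (letter-≢ u u≢b)) (adj-from a u adj)))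
          (λ adj → adj-to a u (proj₂ (same (to u) (letter-≢ u u≢a) (letter-≢ u u≢b)) (adj-from b u adj)))
    where
    letter-≢ : ∀ {c} u → u ≢ from c → to u ≢ c
    letter-≢ u u≢ eq = u≢ (trans (sym (from-to u)) (cong from eq))
    adj-from : ∀ x u → T (Adj G (from x) u) → Interlaced w x (to u)
    adj-from x u adj = subst (λ t → Interlaced w t (to u)) (to-from x) (adj⇒interlaced (from x) u adj)
    adj-to : ∀ x u → Interlaced w x (to u) → T (Adj G (from x) u)
    adj-to x u int = subst (λ t → T (Adj G (from x) t)) (from-to u) (interlaced⇒adj x (to u) int)

  no-twins-word : ¬ HasTwoDisjointTwinPairs G → ¬ TwoDisjointTwins (Interlaced w)
  no-twins-word no-pairs (a₁ , a₂ , a₃ , a₄ , t₁₂ , t₃₄ , a₁≢a₃ , a₁≢a₄ , a₂≢a₃ , a₂≢a₄) =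
    no-pairs (from a₁ , from a₂ , from a₃ , from a₄ , twins-word t₁₂ , twins-word t₃₄ ,
              from-≢ a₁≢a₃ , from-≢ a₁≢a₄ , from-≢ a₂≢a₃ , from-≢ a₂≢a₄)

proposition16 : ∀ (n : ℕ) (G : Graph n) → Cubic G → IsCircleGraph G →
                  ¬ HasTwoDisjointTwinPairs G → ¬ KConnected 3 G
proposition16 (suc n) G cubic (k , w , double , f , adj⇔) no-pairs connected =
  no-counterexample counterexample (Bijection.to f zero)
  where
  open CircleRepresentation G w f adj⇔
  counterexample : Counterexample w
  counterexample = record
    { double = double
    ; cubic = cubic-word cubic
    ; no-small-cut = no-small-cut-word connected
    ; no-twins = no-twins-word no-pairs
    }
proposition16 zero G _ _ _ (() , _)
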